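{- Let $G=(V,E)$ be an atomic bispanning graph with vertex-connectivity $2$ which is the $2$-clique sum $G=G_1\oplus_2G_2$ of two simple bispanning graphs $G_1=(V_1,E_1)$, $G_2=(V_2,E_2)$ at edges $d_1\in E_1$, $d_2\in E_2$. Then there is a bijection between $V_{\tau(G)}$ and $$V_\eta=\{((S_1,T_1),(S_2,T_2))\in V_{\tau(G_1)}\times V_{\tau(G_2)}:\ \text{not }[(d_1\in S_1\text{ and }d_2\in S_2)\text{ or }(d_1\in T_1\text{ and }d_2\in T_2)]\},$$ given by $((S_1,T_1),(S_2,T_2))\mapsto((S_1\cup S_2)\setminus\{d_1,d_2\},(T_1\cup T_2)\setminus\{d_1,d_2\})$, whose inverse sends $(S,T)$ to the pair obtained by restricting $S$ and $T$ to $E_1$ and $E_2$ and adding $d_i$ to whichever of $S\cap E_i$, $T\cap E_i$ has $|V_i|-2$ edges.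
   Context: Graphs are finite, undirected, may have parallel edges, no loops. A graph is bispanning if its edge set is the disjoint union of two spanning trees; atomic if it contains no bispanning subgraph other than itself and $K_1$. The $2$-clique sum at $d_1,d_2$ is obtained from the disjoint union by identifying the ends of $d_1$ bijectively with the ends of $d_2$ and deleting $d_1,d_2$, so $E=(E_1\setminus\{d_1\})\cup(E_2\setminus\{d_2\})$. For a bispanning graph $H$, $V_{\tau(H)}$ is the set of ordered pairs $(S,T)$ of disjoint spanning trees of $H$ with $S\cup T=E(H)$. -}

module Defs where

open import Data.Bool using (Bool; true; false; if_then_else_)
open import Data.Nat using (ℕ; zero; suc; _+_; _∸_; _≡ᵇ_)
open import Data.Fin using (Fin)
import Data.Fin.Properties as FinP
open import Data.Product using (Σ; _×_; _,_; proj₁; proj₂)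
open import Data.Sum using (_⊎_; inj₁; inj₂)
open import Data.Empty using (⊥)
open import Data.Unit using (⊤)
open import Relation.Nullary using (¬_; yes; no)
open import Relation.Binary.PropositionalEquality using (_≡_; _≢_; refl; sym; trans; cong)
open import Relation.Binary.Definitions using (DecidableEquality)
open import Function.Bundles using (_↔_; _↣_; Inverse)

-- Multigraphs: a vertex type, an edge type and an (ordered) pair of ends
-- for every edge.  Parallel edges are allowed; loops are excluded by the
-- hypotheses (Loopless / Simple) where needed.

record Graph : Set₁ where
  field
    V    : Set
    E    : Set
    ends : E → V × V

open Graph public

record Finite (G : Graph) : Set where
  field
    nV   : ℕ
    nE   : ℕ
    V↔   : V G ↔ Fin nV
    E↔   : E G ↔ Fin nE

open Finite public

↔-decEq : {A : Set} {n : ℕ} → A ↔ Fin n → DecidableEquality A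
↔-decEq f x y with FinP._≟_ (Inverse.to f x) (Inverse.to f y)
... | yes p = yes (trans (sym (Inverse.strictlyInverseʳ f x))
                   (trans (cong (Inverse.from f) p) (Inverse.strictlyInverseʳ f y)))
... | no ¬p = no (λ q → ¬p (cong (Inverse.to f) q))

Subset : Set → Set
Subset A = A → Bool

_∈_ : {A : Set} → A → Subset A → Set
a ∈ S = S a ≡ true

full : {A : Set} → Subset A
full _ = true

module _ (G : Graph) where

  src : E G → V G
  src e = proj₁ (ends G e)

  tgt : E G → V G
  tgt e = proj₂ (ends G e)

  Joins : E G → V G → V G → Set
  Joins e u w = (ends G e ≡ (u , w)) ⊎ (ends G e ≡ (w , u))

  data Walk (P : E G → Set) (Q : V G → Set) : V G → V G → Set where
    stay : ∀ {v} → Q v → Walk P Q v v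
    step : ∀ {u w v} (e : E G) → P e → Joins e u w → Q u →
           Walk P Q w v → Walk P Q u v

  Loopless : Set
  Loopless = ∀ e → src e ≢ tgt e

  NoParallelEdges : Set
  NoParallelEdges = ∀ e e′ → e ≢ e′ → ¬ Joins e′ (src e) (tgt e)

  Simple : Set
  Simple = Loopless × NoParallelEdges

  IsSubgraph : Subset (V G) → Subset (E G) → Set
  IsSubgraph W F = ∀ e → e ∈ F → (src e ∈ W) × (tgt e ∈ W)

  -- S is the edge set of a spanning tree of the graph with vertex set W:
  -- (W , S) is connected, and acyclic (no edge e of S lies on a cycle of S,
  -- i.e. the ends of e are not joined by a walk in S - e).
  IsSpanningTreeOn : Subset (V G) → Subset (E G) → Set
  IsSpanningTreeOn W S =
    (∀ u v → u ∈ W → v ∈ W → Walk (λ e → e ∈ S) (λ x → x ∈ W) u v) ×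
    (∀ e → e ∈ S → ¬ Walk (λ e′ → (e′ ∈ S) × (e′ ≢ e)) (λ x → x ∈ W) (src e) (tgt e))

  IsTreePairOn : Subset (V G) → Subset (E G) → Subset (E G) → Subset (E G) → Set
  IsTreePairOn W F S T =
    (∀ e → e ∈ S → e ∈ F) × (∀ e → e ∈ T → e ∈ F) ×
    (∀ e → ¬ ((e ∈ S) × (e ∈ T))) ×
    (∀ e → e ∈ F → (e ∈ S) ⊎ (e ∈ T)) ×
    IsSpanningTreeOn W S × IsSpanningTreeOn W T

  IsTreePair : Subset (E G) × Subset (E G) → Set
  IsTreePair (S , T) = IsTreePairOn full full S T

  Vτ : Set
  Vτ = Σ (Subset (E G) × Subset (E G)) IsTreePair

  BispanningOn : Subset (V G) → Subset (E G) → Set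
  BispanningOn W F = Σ (Subset (E G) × Subset (E G)) (λ p → IsTreePairOn W F (proj₁ p) (proj₂ p))

  Bispanning : Set
  Bispanning = Vτ

  -- atomic: every bispanning subgraph is G itself or has at most one vertex
  -- (i.e. is K₁; the empty vertex set is not a graph)
  Atomic : Set
  Atomic = ∀ W F → IsSubgraph W F → BispanningOn W F →
           (∀ u v → u ∈ W → v ∈ W → u ≡ v) ⊎ ((∀ v → v ∈ W) × (∀ e → e ∈ F))

  ConnectedAfterRemoving : (V G → Set) → Set
  ConnectedAfterRemoving X =
    ∀ u v → ¬ X u → ¬ X v → Walk (λ _ → ⊤) (λ w → ¬ X w) u v

  -- k-connected for k = 2, 3: more than k vertices, and G - X connected
  -- for every vertex set X with |X| < k
  TwoConnected : Set
  TwoConnected = (Fin 3 ↣ V G) ×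
    ConnectedAfterRemoving (λ _ → ⊥) × (∀ a → ConnectedAfterRemoving (λ w → w ≡ a))

  ThreeConnected : Set
  ThreeConnected = (Fin 4 ↣ V G) ×
    ConnectedAfterRemoving (λ _ → ⊥) ×
    (∀ a b → ConnectedAfterRemoving (λ w → (w ≡ a) ⊎ (w ≡ b)))

  VertexConnectivity2 : Set
  VertexConnectivity2 = TwoConnected × ¬ ThreeConnected

-- The 2-clique sum G₁ ⊕₂ G₂ at d₁, d₂: the ends of d₂ are identified with
-- those of d₁ (src d₂ ↦ src d₁, tgt d₂ ↦ tgt d₁) and d₁, d₂ are deleted.

module _ (G₁ G₂ : Graph) (F₂ : Finite G₂) (d₁ : E G₁) (d₂ : E G₂) where

  CSV : Set
  CSV = V G₁ ⊎ Σ (V G₂) (λ v → (v ≢ src G₂ d₂) × (v ≢ tgt G₂ d₂))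

  CSE : Set
  CSE = Σ (E G₁) (λ e → e ≢ d₁) ⊎ Σ (E G₂) (λ e → e ≢ d₂)

  ι₂ : V G₂ → CSV
  ι₂ v with ↔-decEq (V↔ F₂) v (src G₂ d₂)
  ... | yes _ = inj₁ (src G₁ d₁)
  ... | no p with ↔-decEq (V↔ F₂) v (tgt G₂ d₂)
  ...   | yes _ = inj₁ (tgt G₁ d₁)
  ...   | no q  = inj₂ (v , p , q)

  CSends : CSE → CSV × CSV
  CSends (inj₁ (e , _)) = inj₁ (src G₁ e) , inj₁ (tgt G₁ e)
  CSends (inj₂ (e , _)) = ι₂ (src G₂ e) , ι₂ (tgt G₂ e)

  cliqueSum : Graph
  cliqueSum = record { V = CSV ; E = CSE ; ends = CSends }

countFin : (n : ℕ) → (Fin n → Bool) → ℕ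
countFin zero    f = 0
countFin (suc n) f = (if f Fin.zero then 1 else 0) + countFin n (λ i → f (Fin.suc i))

module _ (G₁ G₂ : Graph) (F₁ : Finite G₁) (F₂ : Finite G₂) (d₁ : E G₁) (d₂ : E G₂) where

  private
    G : Graph
    G = cliqueSum G₁ G₂ F₂ d₁ d₂

  ηCond : (Subset (E G₁) × Subset (E G₁)) → (Subset (E G₂) × Subset (E G₂)) → Set
  ηCond (S₁ , T₁) (S₂ , T₂) =
    ¬ (((d₁ ∈ S₁) × (d₂ ∈ S₂)) ⊎ ((d₁ ∈ T₁) × (d₂ ∈ T₂)))

  Vη : Set
  Vη = Σ (Vτ G₁ × Vτ G₂) (λ p → ηCond (proj₁ (proj₁ p)) (proj₁ (proj₂ p)))

  glue : Subset (E G₁) → Subset (E G₂) → Subset (E G)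
  glue A₁ A₂ (inj₁ (e , _)) = A₁ e
  glue _  A₂ (inj₂ (e , _)) = A₂ e

  η : Vη → Subset (E G) × Subset (E G)
  η (((( S₁ , T₁ ) , _) , ((S₂ , T₂) , _)) , _) = glue S₁ S₂ , glue T₁ T₂

  restrict₁ : Subset (E G) → Subset (E G₁)
  restrict₁ A e with ↔-decEq (E↔ F₁) e d₁
  ... | yes _ = false
  ... | no p  = A (inj₁ (e , p))

  restrict₂ : Subset (E G) → Subset (E G₂)
  restrict₂ A e with ↔-decEq (E↔ F₂) e d₂
  ... | yes _ = false
  ... | no p  = A (inj₂ (e , p))

  side₁ : Subset (E G) → Subset (E G₁)
  side₁ A e with ↔-decEq (E↔ F₁) e d₁
  ... | yes _ = countFin (nE F₁) (λ i → restrict₁ A (Inverse.from (E↔ F₁) i)) ≡ᵇ (nV F₁ ∸ 2)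
  ... | no p  = A (inj₁ (e , p))

  side₂ : Subset (E G) → Subset (E G₂)
  side₂ A e with ↔-decEq (E↔ F₂) e d₂
  ... | yes _ = countFin (nE F₂) (λ i → restrict₂ A (Inverse.from (E↔ F₂) i)) ≡ᵇ (nV F₂ ∸ 2)
  ... | no p  = A (inj₂ (e , p))

  θ : Subset (E G) × Subset (E G) →
      (Subset (E G₁) × Subset (E G₁)) × (Subset (E G₂) × Subset (E G₂))
  θ (S , T) = (side₁ S , side₁ T) , (side₂ S , side₂ T)

_≐_ : {A : Set} → Subset A → Subset A → Set
S ≐ S′ = ∀ a → S a ≡ S′ a

module Submission where

-- A spanning tree S of G = G₁ ⊕₂ G₂, restricted to Eᵢ ∖ {dᵢ}, is a forest of Gᵢ (a cycle there would
-- lift to a cycle of G), so it has at most |Vᵢ| - 1 edges.  Since G, G₁, G₂ are bispanning,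
-- |Eᵢ| = 2|Vᵢ| - 2 and |V| = |V₁| + |V₂| - 2, and these counts leave no choice: on each side one of
-- S, T restricts to a spanning tree of Gᵢ - dᵢ and the other to a forest with two components, and
-- the roles are exchanged on the other side.  The ends of dᵢ lie in different components of the
-- smaller forest, since the other side already joins them and a second connection would close a
-- cycle in G; so adding dᵢ yields a spanning tree of Gᵢ.  Conversely, gluing spanning trees of G₁
-- and G₂ of which exactly one contains its dᵢ gives a connected subgraph of G with |V| - 1 edges,
-- hence a spanning tree.

open import Defs
open import Data.Bool using (Bool; true; false; _∧_; not)
import Data.Bool as Bool
open import Data.Bool.Properties using (∧-zeroʳ; ∧-identityʳ; not-involutive)
open import Data.Nat using (ℕ; zero; suc; _+_; _∸_; _≤_; _≡ᵇ_; _≟_; z≤n; s≤s)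
open import Data.Nat.Properties
  using (≤-trans; ≤-antisym; ≤-reflexive; +-suc; +-identityʳ; +-comm; +-mono-≤; +-monoˡ-≤;
         m≤n⇒m≤1+n; +-cancelʳ-≡; +-cancelˡ-≡; suc-injective; <-irrefl; 1+n≢n; m≤n⇒∃[o]m+o≡n; module ≤-Reasoning;
         +-commutativeSemigroup)
open import Algebra.Properties.CommutativeSemigroup +-commutativeSemigroup using (interchange)
open import Data.Fin using (Fin; _↑ˡ_; _↑ʳ_; splitAt; join) renaming (zero to fz; suc to fs)
import Data.Fin.Properties as FinP
open import Data.List using (List; []; _∷_; length; _++_; filter)
open import Data.List.Properties using (length-++)
open import Data.List.Relation.Unary.Any using (here; there)
open import Data.List.Relation.Unary.All using ([])
open import Data.List.Relation.Unary.All.Properties using (All¬⇒¬Any; ¬Any⇒All¬)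
open import Data.List.Relation.Unary.AllPairs using ([]; _∷_)
open import Data.List.Relation.Unary.Unique.Propositional using (Unique)
open import Data.List.Relation.Unary.Unique.Propositional.Properties using (++⁺; filter⁺)
open import Data.List.Membership.Propositional using () renaming (_∈_ to _∈ˡ_)
open import Data.List.Membership.Propositional.Properties using (∈-++⁺ˡ; ∈-++⁺ʳ; ∈-++⁻; ∈-filter⁻)
open import Data.Maybe using (Maybe; just; nothing; maybe′)
open import Data.Maybe.Properties using (just-injective)
open import Data.Product using (Σ; _×_; _,_; proj₁; proj₂)
open import Data.Sum using (_⊎_; inj₁; inj₂)
import Data.Sum
open import Data.Empty using (⊥; ⊥-elim)
open import Data.Unit using (⊤; tt)
open import Function using (id; _∘_)
open import Function.Bundles using (Inverse; Injection; _↔_)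
open import Function.Properties.Inverse using (↔⇒↣)
open import Relation.Nullary using (¬_; yes; no; Dec; does)
open import Relation.Nullary.Decidable using (dec-true; dec-false; decidable-stable)
open import Relation.Binary.PropositionalEquality
  using (_≡_; _≢_; refl; sym; trans; cong; cong₂; subst; subst₂; module ≡-Reasoning)

-- Counting

countFin-cong : ∀ n {f g : Fin n → Bool} → (∀ k → f k ≡ g k) → countFin n f ≡ countFin n g
countFin-cong zero    f≗g = refl
countFin-cong (suc n) f≗g rewrite f≗g fz = cong (_ +_) (countFin-cong n (λ k → f≗g (fs k)))

countFin-false : ∀ n {f : Fin n → Bool} → (∀ k → f k ≡ false) → countFin n f ≡ 0
countFin-false zero    f≡false = refl
countFin-false (suc n) f≡false rewrite f≡false fz = countFin-false n (λ k → f≡false (fs k))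

countFin-true : ∀ n {f : Fin n → Bool} → (∀ k → f k ≡ true) → countFin n f ≡ n
countFin-true zero    f≡true = refl
countFin-true (suc n) f≡true rewrite f≡true fz = cong suc (countFin-true n (λ k → f≡true (fs k)))

countFin-remove : ∀ n (f g : Fin n → Bool) (j : Fin n) → f j ≡ true → g j ≡ false →
                  (∀ k → k ≢ j → g k ≡ f k) → suc (countFin n g) ≡ countFin n f
countFin-remove (suc n) f g fz fj gj g≗f rewrite fj | gj =
  cong suc (countFin-cong n (λ k → g≗f (fs k) (λ ())))
countFin-remove (suc n) f g (fs j) fj gj g≗f rewrite g≗f fz (λ ()) with f fz
... | true  = cong suc (countFin-remove n _ _ j fj gj (λ k k≢j → g≗f (fs k) (λ e → k≢j (FinP.suc-injective e))))
... | false = countFin-remove n _ _ j fj gj (λ k k≢j → g≗f (fs k) (λ e → k≢j (FinP.suc-injective e)))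

countFin-pos : ∀ n (f : Fin n → Bool) k → f k ≡ true → 1 ≤ countFin n f
countFin-pos (suc n) f fz     fk rewrite fk = s≤s z≤n
countFin-pos (suc n) f (fs k) fk with f fz
... | true  = s≤s z≤n
... | false = countFin-pos n _ k fk

private
  only-true-at-zero : ∀ n (f : Fin (suc n) → Bool) → f fz ≡ true →
    (∀ k k′ → f k ≡ true → f k′ ≡ true → k ≡ k′) → ∀ k → f (fs k) ≡ false
  only-true-at-zero n f f0 unique k with f (fs k) in fk
  ... | true  with () ← unique fz (fs k) f0 fk
  ... | false = refl

countFin-≤1 : ∀ n (f : Fin n → Bool) → (∀ k k′ → f k ≡ true → f k′ ≡ true → k ≡ k′) → countFin n f ≤ 1
countFin-≤1 zero    f unique = z≤n
countFin-≤1 (suc n) f unique with f fz in f0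
... | true  rewrite countFin-false n (only-true-at-zero n f f0 unique) = s≤s z≤n
... | false = countFin-≤1 n _ (λ k k′ a b → FinP.suc-injective (unique (fs k) (fs k′) a b))

countFin-≥2 : ∀ n (f : Fin n → Bool) k k′ → f k ≡ true → f k′ ≡ true → k ≢ k′ → 2 ≤ countFin n f
countFin-≥2 (suc n) f fz     fz      a b k≢k′ = ⊥-elim (k≢k′ refl)
countFin-≥2 (suc n) f fz     (fs k′) a b k≢k′ rewrite a = s≤s (countFin-pos n _ k′ b)
countFin-≥2 (suc n) f (fs k) fz      a b k≢k′ rewrite b = s≤s (countFin-pos n _ k a)
countFin-≥2 (suc n) f (fs k) (fs k′) a b k≢k′ with f fz
... | true  = m≤n⇒m≤1+n (countFin-≥2 n _ k k′ a b (λ e → k≢k′ (cong fs e)))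
... | false = countFin-≥2 n _ k k′ a b (λ e → k≢k′ (cong fs e))

countFin-complement : ∀ n (f g : Fin n → Bool) → (∀ k → f k ≡ not (g k)) →
                      countFin n f + countFin n g ≡ n
countFin-complement zero    f g f≗¬g = refl
countFin-complement (suc n) f g f≗¬g rewrite f≗¬g fz with g fz
... | true  = trans (+-suc _ _) (cong suc (countFin-complement n _ _ (λ k → f≗¬g (fs k))))
... | false = cong suc (countFin-complement n _ _ (λ k → f≗¬g (fs k)))

countFin-complement-except : ∀ n (f g : Fin n → Bool) (j : Fin n) → f j ≡ false → g j ≡ false →
  (∀ k → k ≢ j → f k ≡ not (g k)) → suc (countFin n f + countFin n g) ≡ n
countFin-complement-except n f g j fj gj f≗¬g = begin
  suc (countFin n f + countFin n g)     ≡⟨ cong suc (+-comm (countFin n f) _) ⟩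
  suc (countFin n g) + countFin n f     ≡⟨ cong (_+ countFin n f) (countFin-remove n ¬f g j (cong not fj) gj g≗¬f) ⟩
  countFin n ¬f + countFin n f          ≡⟨ +-comm (countFin n ¬f) _ ⟩
  countFin n f + countFin n ¬f          ≡⟨ countFin-complement n f ¬f (λ k → sym (not-involutive (f k))) ⟩
  n                                     ∎
  where
  open ≡-Reasoning
  ¬f : Fin n → Bool
  ¬f k = not (f k)
  g≗¬f : ∀ k → k ≢ j → g k ≡ ¬f k
  g≗¬f k k≢j = trans (sym (not-involutive (g k))) (cong not (sym (f≗¬g k k≢j)))

countFin-↑ : ∀ m k (f : Fin (m + k) → Bool) →
  countFin (m + k) f ≡ countFin m (λ i → f (i ↑ˡ k)) + countFin k (λ i → f (m ↑ʳ i))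
countFin-↑ zero    k f = refl
countFin-↑ (suc m) k f with f fz
... | true  = cong suc (countFin-↑ m k (λ i → f (fs i)))
... | false = countFin-↑ m k (λ i → f (fs i))

extract : {A : Set} {x : A} (xs : List A) → x ∈ˡ xs →
  Σ (List A) (λ r → (∀ {y} → y ∈ˡ xs → y ∈ˡ x ∷ r) × (length xs ≡ suc (length r)))
extract (x ∷ xs) (here refl) = xs , id , refl
extract (z ∷ xs) (there x∈xs) with extract xs x∈xs
... | r , sub , len = z ∷ r , sub′ , cong suc len
  where
  sub′ : ∀ {y} → y ∈ˡ z ∷ xs → y ∈ˡ _ ∷ z ∷ r
  sub′ (here y≡z) = there (here y≡z)
  sub′ (there y∈xs) with sub y∈xs
  ... | here y≡x    = here y≡x
  ... | there y∈r   = there (there y∈r)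

module _ {X : Set} where

  private
    in-tail : ∀ {k} {h : Fin (suc k) → Maybe X} (A : Subset X) {x} →
      Σ (Fin k) (λ i → h (fs i) ≡ just x) × (x ∈ A) → Σ (Fin (suc k)) (λ i → h i ≡ just x) × (x ∈ A)
    in-tail A ((i , hi) , x∈A) = (fs i , hi) , x∈A

  collect : (k : ℕ) → (Fin k → Maybe X) → Subset X → List X
  collect zero    h A = []
  collect (suc k) h A with h fz
  ... | nothing = collect k (h ∘ fs) A
  ... | just x with A x
  ...   | true  = x ∷ collect k (h ∘ fs) A
  ...   | false = collect k (h ∘ fs) A

  length-collect : ∀ k h A → length (collect k h A) ≡ countFin k (maybe′ A false ∘ h)
  length-collect zero    h A = refl
  length-collect (suc k) h A with h fz
  ... | nothing = length-collect k (h ∘ fs) A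
  ... | just x with A x
  ...   | true  = cong suc (length-collect k (h ∘ fs) A)
  ...   | false = length-collect k (h ∘ fs) A

  ∈-collect⁻ : ∀ k h A {x} → x ∈ˡ collect k h A → Σ (Fin k) (λ i → h i ≡ just x) × (x ∈ A)
  ∈-collect⁻ (suc k) h A x∈ with h fz in h0
  ∈-collect⁻ (suc k) h A x∈ | nothing = in-tail A (∈-collect⁻ k (h ∘ fs) A x∈)
  ∈-collect⁻ (suc k) h A x∈ | just y with A y in Ay
  ∈-collect⁻ (suc k) h A x∈          | just y | false = in-tail A (∈-collect⁻ k (h ∘ fs) A x∈)
  ∈-collect⁻ (suc k) h A (here refl) | just y | true  = (fz , h0) , Ay
  ∈-collect⁻ (suc k) h A (there x∈)  | just y | true  = in-tail A (∈-collect⁻ k (h ∘ fs) A x∈)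

  ∈-collect⁺ : ∀ k h A {x} (i : Fin k) → h i ≡ just x → x ∈ A → x ∈ˡ collect k h A
  ∈-collect⁺ (suc k) h A fz     hi x∈A rewrite hi | x∈A = here refl
  ∈-collect⁺ (suc k) h A (fs i) hi x∈A with h fz
  ... | nothing = ∈-collect⁺ k (h ∘ fs) A i hi x∈A
  ... | just y with A y
  ...   | true  = there (∈-collect⁺ k (h ∘ fs) A i hi x∈A)
  ...   | false = ∈-collect⁺ k (h ∘ fs) A i hi x∈A

  PartialInjective : ∀ {k} → (Fin k → Maybe X) → Set
  PartialInjective h = ∀ i j {x} → h i ≡ just x → h j ≡ just x → i ≡ j

  tail-injective : ∀ {k} {h : Fin (suc k) → Maybe X} → PartialInjective h → PartialInjective (h ∘ fs)
  tail-injective h-inj i j hi hj = FinP.suc-injective (h-inj (fs i) (fs j) hi hj)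

  collect-unique : ∀ k h A → PartialInjective h → Unique (collect k h A)
  collect-unique zero    h A h-inj = []
  collect-unique (suc k) h A h-inj with h fz in h0
  ... | nothing = collect-unique k (h ∘ fs) A (tail-injective h-inj)
  ... | just y with A y
  ...   | false = collect-unique k (h ∘ fs) A (tail-injective h-inj)
  ...   | true  = ¬Any⇒All¬ _ y∉ ∷ collect-unique k (h ∘ fs) A (tail-injective h-inj)
    where
    y∉ : ¬ y ∈ˡ collect k (h ∘ fs) A
    y∉ y∈ with ∈-collect⁻ k (h ∘ fs) A y∈
    ... | (i , hi) , _ with () ← h-inj fz (fs i) h0 hi

length-filter-complement : {X : Set} (S T : Subset X) → (∀ x → S x ≡ not (T x)) → ∀ xs →
  length (filter (λ x → S x Bool.≟ true) xs) + length (filter (λ x → T x Bool.≟ true) xs) ≡ length xs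
length-filter-complement S T S≗¬T []       = refl
length-filter-complement S T S≗¬T (x ∷ xs) with S x | T x | S≗¬T x
... | true  | false | _ = cong suc (length-filter-complement S T S≗¬T xs)
... | false | true  | _ = trans (+-suc _ _) (cong suc (length-filter-complement S T S≗¬T xs))

-- Walks, forests and spanning trees

EdgeWalk : (H : Graph) → (E H → Set) → V H → V H → Set
EdgeWalk H P = Walk H P (_∈ full)

module _ {H : Graph} where

  map-walk : {P P′ : E H → Set} → (∀ e → P e → P′ e) → ∀ {u v} → EdgeWalk H P u v → EdgeWalk H P′ u v
  map-walk f (stay q)            = stay q
  map-walk f (step e pe j q w)   = step e (f e pe) j q (map-walk f w)

  _++ʷ_ : {P : E H → Set} → ∀ {u v w} → EdgeWalk H P u v → EdgeWalk H P v w → EdgeWalk H P u w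
  stay q            ++ʷ w′ = w′
  step e pe j q w   ++ʷ w′ = step e pe j q (w ++ʷ w′)

  joins-sym : ∀ {e u w} → Joins H e u w → Joins H e w u
  joins-sym (inj₁ x) = inj₂ x
  joins-sym (inj₂ y) = inj₁ y

  reverse-walk : {P : E H → Set} → ∀ {u v} → EdgeWalk H P u v → EdgeWalk H P v u
  reverse-walk (stay q)          = stay q
  reverse-walk (step e pe j q w) = reverse-walk w ++ʷ step e pe (joins-sym j) refl (stay refl)

  edge-walk : {P : E H → Set} → ∀ e → P e → EdgeWalk H P (src H e) (tgt H e)
  edge-walk e pe = step e pe (inj₁ refl) refl (stay refl)

  cast-walk : {P : E H → Set} → ∀ {a b c d} → a ≡ c → b ≡ d → EdgeWalk H P a b → EdgeWalk H P c d
  cast-walk refl refl w = w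

map-walk-across : (H H′ : Graph) {P : E H → Set} {Q : E H′ → Set} (φ : V H → V H′) →
  (∀ e → P e → EdgeWalk H′ Q (φ (src H e)) (φ (tgt H e))) →
  ∀ {u v} → EdgeWalk H P u v → EdgeWalk H′ Q (φ u) (φ v)
map-walk-across H H′ φ image (stay _) = stay refl
map-walk-across H H′ φ image (step e pe (inj₁ eq) _ w) =
  cast-walk (cong (λ x → φ (proj₁ x)) eq) (cong (λ x → φ (proj₂ x)) eq) (image e pe)
    ++ʷ map-walk-across H H′ φ image w
map-walk-across H H′ φ image (step e pe (inj₂ eq) _ w) =
  reverse-walk (cast-walk (cong (λ x → φ (proj₁ x)) eq) (cong (λ x → φ (proj₂ x)) eq) (image e pe))
    ++ʷ map-walk-across H H′ φ image w

module _ (H : Graph) where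

  Connected : (E H → Set) → Set
  Connected P = ∀ u v → EdgeWalk H P u v

  Acyclic : (E H → Set) → Set
  Acyclic P = ∀ e → P e → ¬ EdgeWalk H (λ x → P x × x ≢ e) (src H e) (tgt H e)

  AcyclicList : List (E H) → Set
  AcyclicList []      = ⊤
  AcyclicList (e ∷ L) = ¬ EdgeWalk H (_∈ˡ L) (src H e) (tgt H e) × AcyclicList L

  Acyclic⇒AcyclicList : ∀ L {P} → Unique L → (∀ {x} → x ∈ˡ L → P x) → Acyclic P → AcyclicList L
  Acyclic⇒AcyclicList []      _              _   _       = tt
  Acyclic⇒AcyclicList (e ∷ L) (e∉L ∷ unique) L⊆P acyclic =
    (λ w → acyclic e (L⊆P (here refl)) (map-walk (λ x x∈L → L⊆P (there x∈L) , e≢x x∈L) w)) ,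
    Acyclic⇒AcyclicList L unique (λ x∈L → L⊆P (there x∈L)) acyclic
    where
    e≢x : ∀ {x} → x ∈ˡ L → x ≢ e
    e≢x x∈L refl = All¬⇒¬Any e∉L x∈L

  AcyclicList-snoc : ∀ L d {P : E H → Set} → Unique (L ++ d ∷ []) → (∀ {x} → x ∈ˡ L ++ d ∷ [] → P x) →
    (∀ e → P e → e ≢ d → ¬ EdgeWalk H (λ x → P x × x ≢ e) (src H e) (tgt H e)) →
    src H d ≢ tgt H d → AcyclicList (L ++ d ∷ [])
  AcyclicList-snoc []      d _              _   _       d-proper = (λ w → d-proper (edgeless w)) , tt
    where
    edgeless : ∀ {u v} → EdgeWalk H (_∈ˡ []) u v → u ≡ v
    edgeless (stay _)          = refl
    edgeless (step _ () _ _ _)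
  AcyclicList-snoc (e ∷ L) d (e∉ ∷ unique) L⊆P acyclic d-proper =
    (λ w → acyclic e (L⊆P (here refl)) e≢d (map-walk (λ x x∈ → L⊆P (there x∈) , e≢x x∈) w)) ,
    AcyclicList-snoc L d unique (λ x∈ → L⊆P (there x∈)) acyclic d-proper
    where
    e≢x : ∀ {x} → x ∈ˡ L ++ d ∷ [] → x ≢ e
    e≢x x∈ refl = All¬⇒¬Any e∉ x∈
    e≢d : e ≢ d
    e≢d refl = e≢x (∈-++⁺ʳ L (here refl)) refl

SpanningTree : (H : Graph) → Subset (E H) → Set
SpanningTree H S = IsSpanningTreeOn H full S

spanningTree-connected : ∀ {H S} → SpanningTree H S → Connected H (_∈ S)
spanningTree-connected (conn , _) u v = conn u v refl refl

spanningTree : ∀ {H S} → Connected H (_∈ S) → Acyclic H (_∈ S) → SpanningTree H S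
spanningTree conn acyclic = (λ u v _ _ → conn u v) , acyclic

module _ {H : Graph} {S T : Subset (E H)} where

  treePair-left : IsTreePair H (S , T) → SpanningTree H S
  treePair-left (_ , _ , _ , _ , treeS , _) = treeS

  treePair-right : IsTreePair H (S , T) → SpanningTree H T
  treePair-right (_ , _ , _ , _ , _ , treeT) = treeT

  treePair-complement : IsTreePair H (S , T) → ∀ e → S e ≡ not (T e)
  treePair-complement (_ , _ , disjoint , covers , _) e with S e in Se | T e in Te
  ... | true  | true  = ⊥-elim (disjoint e (Se , Te))
  ... | true  | false = refl
  ... | false | true  = refl
  ... | false | false with covers e refl
  ...   | inj₂ T∋e with () ← trans (sym Te) T∋e
  treePair-complement _ e | false | false | inj₁ S∋e with () ← trans (sym Se) S∋e

  complement-treePair : (∀ e → S e ≡ not (T e)) → SpanningTree H S → SpanningTree H T → IsTreePair H (S , T)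
  complement-treePair S≗¬T treeS treeT = (λ _ _ → refl) , (λ _ _ → refl) , disjoint , covers , treeS , treeT
    where
    disjoint : ∀ e → ¬ ((e ∈ S) × (e ∈ T))
    disjoint e (S∋e , T∋e) with () ← trans (sym S∋e) (trans (S≗¬T e) (cong not T∋e))
    covers : ∀ e → e ∈ full → (e ∈ S) ⊎ (e ∈ T)
    covers e _ with T e in Te
    ... | true  = inj₂ refl
    ... | false = inj₁ (trans (S≗¬T e) (cong not Te))

treePair-swap : ∀ {H S T} → IsTreePair H (S , T) → IsTreePair H (T , S)
treePair-swap (S⊆ , T⊆ , disjoint , covers , treeS , treeT) =
  T⊆ , S⊆ , (λ e (T∋e , S∋e) → disjoint e (S∋e , T∋e)) , (λ e e∈ → Data.Sum.swap (covers e e∈)) , treeT , treeS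

-- Union–find

-- An injection of the vertices into Fin N with decidable image, so that components can be
-- labelled by elements of Fin N and vertexCount is the number of vertices.
record Indexing (H : Graph) : Set where
  field
    N               : ℕ
    index           : V H → Fin N
    occupied        : Fin N → Bool
    occupied-index  : ∀ v → occupied (index v) ≡ true
    vertexAt        : (k : Fin N) → occupied k ≡ true → V H
    index-vertexAt  : ∀ k p → index (vertexAt k p) ≡ k
    index-injective : ∀ u v → index u ≡ index v → u ≡ v

  vertexCount : ℕ
  vertexCount = countFin N occupied

-- label L sends every vertex index to a representative of its component in the subgraph
-- formed by the edges of L; each edge that merges two components removes one representative.
module Components (H : Graph) (ix : Indexing H) where
  open Indexing ix

  relabel : Fin N → Fin N → (Fin N → Fin N) → Fin N → Fin N
  relabel i j c k with c k FinP.≟ j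
  ... | yes _ = i
  ... | no  _ = c k

  relabel-hit : ∀ i j c k → c k ≡ j → relabel i j c k ≡ i
  relabel-hit i j c k ck≡j with c k FinP.≟ j
  ... | yes _    = refl
  ... | no  ck≢j = ⊥-elim (ck≢j ck≡j)

  relabel-miss : ∀ i j c k → c k ≢ j → relabel i j c k ≡ c k
  relabel-miss i j c k ck≢j with c k FinP.≟ j
  ... | yes ck≡j = ⊥-elim (ck≢j ck≡j)
  ... | no  _    = refl

  relabel-cong : ∀ i j c k k′ → c k ≡ c k′ → relabel i j c k ≡ relabel i j c k′
  relabel-cong i j c k k′ ck≡ck′ with c k FinP.≟ j
  ... | yes ck≡j = sym (relabel-hit i j c k′ (trans (sym ck≡ck′) ck≡j))
  ... | no  ck≢j = trans ck≡ck′ (sym (relabel-miss i j c k′ (λ e → ck≢j (trans ck≡ck′ e))))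

  label : List (E H) → Fin N → Fin N
  label []      = id
  label (e ∷ L) = relabel (label L (index (src H e))) (label L (index (tgt H e))) (label L)

  record IsLabelling (c : Fin N → Fin N) : Set where
    field
      idempotent        : ∀ k → c (c k) ≡ c k
      fixes-unoccupied  : ∀ k → occupied k ≡ false → c k ≡ k
      keeps-occupied    : ∀ k → occupied k ≡ true → occupied (c k) ≡ true

    occupied-label : ∀ v → occupied (c (index v)) ≡ true
    occupied-label v = keeps-occupied (index v) (occupied-index v)

  relabel-isLabelling : ∀ c a b → IsLabelling c → IsLabelling (relabel (c (index a)) (c (index b)) c)
  relabel-isLabelling c a b isL = record
    { idempotent = idem ; fixes-unoccupied = fixes ; keeps-occupied = keeps }
    where
    open IsLabelling isL
    i = c (index a)
    j = c (index b)
    idem : ∀ k → relabel i j c (relabel i j c k) ≡ relabel i j c k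
    idem k with c k FinP.≟ j
    ... | no  ck≢j = trans (relabel-miss i j c (c k) (λ e → ck≢j (trans (sym (idempotent k)) e))) (idempotent k)
    ... | yes _ with c i FinP.≟ j
    ...   | yes _ = refl
    ...   | no  _ = idempotent (index a)
    fixes : ∀ k → occupied k ≡ false → relabel i j c k ≡ k
    fixes k unocc with c k FinP.≟ j
    ... | yes ck≡j with () ← trans (sym unocc)
                              (trans (cong occupied (trans (sym (fixes-unoccupied k unocc)) ck≡j)) (occupied-label b))
    ... | no  _    = fixes-unoccupied k unocc
    keeps : ∀ k → occupied k ≡ true → occupied (relabel i j c k) ≡ true
    keeps k occ with c k FinP.≟ j
    ... | yes _ = occupied-label a
    ... | no  _ = keeps-occupied k occ

  label-isLabelling : ∀ L → IsLabelling (label L)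
  label-isLabelling []      = record
    { idempotent = λ _ → refl ; fixes-unoccupied = λ _ _ → refl ; keeps-occupied = λ _ occ → occ }
  label-isLabelling (e ∷ L) = relabel-isLabelling (label L) (src H e) (tgt H e) (label-isLabelling L)

  isRoot : (Fin N → Fin N) → Fin N → Bool
  isRoot c k = occupied k ∧ does (c k FinP.≟ k)

  componentCount : (Fin N → Fin N) → ℕ
  componentCount c = countFin N (isRoot c)

  isRoot⁻ : ∀ c k → isRoot c k ≡ true → (occupied k ≡ true) × (c k ≡ k)
  isRoot⁻ c k root with occupied k | c k FinP.≟ k
  isRoot⁻ c k refl | true | yes ck≡k = refl , ck≡k

  isRoot-label : ∀ L v → isRoot (label L) (label L (index v)) ≡ true
  isRoot-label L v rewrite IsLabelling.occupied-label (label-isLabelling L) v =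
    dec-true (_ FinP.≟ _) (IsLabelling.idempotent (label-isLabelling L) (index v))

  componentCount-unmerged : ∀ c a b → c (index a) ≡ c (index b) →
    componentCount (relabel (c (index a)) (c (index b)) c) ≡ componentCount c
  componentCount-unmerged c a b i≡j = countFin-cong N unchanged
    where
    unchanged : ∀ k → isRoot (relabel (c (index a)) (c (index b)) c) k ≡ isRoot c k
    unchanged k with c k FinP.≟ c (index b)
    ... | yes ck≡j rewrite trans i≡j (sym ck≡j) = refl
    ... | no  _    = refl

  componentCount-merged : ∀ c a b → IsLabelling c → c (index a) ≢ c (index b) →
    suc (componentCount (relabel (c (index a)) (c (index b)) c)) ≡ componentCount c
  componentCount-merged c a b isL i≢j = countFin-remove N (isRoot c) (isRoot c′) j j-root j-unrooted others
    where
    open IsLabelling isL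
    i = c (index a)
    j = c (index b)
    c′ = relabel i j c
    j-root : isRoot c j ≡ true
    j-root rewrite occupied-label b = dec-true (c j FinP.≟ j) (idempotent (index b))
    j-unrooted : isRoot c′ j ≡ false
    j-unrooted rewrite relabel-hit i j c j (idempotent (index b)) =
      trans (cong (occupied j ∧_) (dec-false (i FinP.≟ j) i≢j)) (∧-zeroʳ (occupied j))
    others : ∀ k → k ≢ j → isRoot c′ k ≡ isRoot c k
    others k k≢j with c k FinP.≟ j
    ... | no  _    = refl
    ... | yes ck≡j = begin
      occupied k ∧ does (i FinP.≟ k)      ≡⟨ cong (occupied k ∧_) (dec-false (i FinP.≟ k) i≢k) ⟩
      occupied k ∧ false                  ≡⟨ cong (occupied k ∧_) (sym (dec-false (c k FinP.≟ k) ck≢k)) ⟩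
      occupied k ∧ does (c k FinP.≟ k)    ∎
      where
      open ≡-Reasoning
      i≢k : i ≢ k
      i≢k i≡k = i≢j (trans (sym (idempotent (index a))) (trans (cong c i≡k) ck≡j))
      ck≢k : c k ≢ k
      ck≢k ck≡k = k≢j (trans (sym ck≡k) ck≡j)

  merges : List (E H) → ℕ
  merges []      = 0
  merges (e ∷ L) with label L (index (src H e)) FinP.≟ label L (index (tgt H e))
  ... | yes _ = merges L
  ... | no  _ = suc (merges L)

  components+merges : ∀ L → componentCount (label L) + merges L ≡ vertexCount
  components+merges []      = trans (+-identityʳ _) (countFin-cong N occupied-root)
    where
    occupied-root : ∀ k → isRoot id k ≡ occupied k
    occupied-root k rewrite dec-true (k FinP.≟ k) refl = ∧-identityʳ (occupied k)
  components+merges (e ∷ L) with label L (index (src H e)) FinP.≟ label L (index (tgt H e))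
  ... | yes i≡j = trans (cong (_+ merges L) (componentCount-unmerged (label L) (src H e) (tgt H e) i≡j))
                        (components+merges L)
  ... | no  i≢j = trans (+-suc _ (merges L))
                   (trans (cong (_+ merges L)
                                (componentCount-merged (label L) (src H e) (tgt H e) (label-isLabelling L) i≢j))
                          (components+merges L))

  merges≤length : ∀ L → merges L ≤ length L
  merges≤length []      = z≤n
  merges≤length (e ∷ L) with label L (index (src H e)) FinP.≟ label L (index (tgt H e))
  ... | yes _ = m≤n⇒m≤1+n (merges≤length L)
  ... | no  _ = s≤s (merges≤length L)

  sameLabel⇒walk : ∀ L u v → label L (index u) ≡ label L (index v) → EdgeWalk H (_∈ˡ L) u v
  sameLabel⇒walk []      u v eq rewrite index-injective u v eq = stay refl
  sameLabel⇒walk (e ∷ L) u v eq =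
    go (label L (index u) FinP.≟ j) (label L (index v) FinP.≟ j)
    where
    c = label L
    i = c (index (src H e))
    j = c (index (tgt H e))
    weaken : ∀ {x y} → EdgeWalk H (_∈ˡ L) x y → EdgeWalk H (_∈ˡ e ∷ L) x y
    weaken = map-walk (λ _ → there)
    within : ∀ x y → c (index x) ≡ c (index y) → EdgeWalk H (_∈ˡ e ∷ L) x y
    within x y eq′ = weaken (sameLabel⇒walk L x y eq′)
    go : Dec (c (index u) ≡ j) → Dec (c (index v) ≡ j) → EdgeWalk H (_∈ˡ e ∷ L) u v
    go (yes u~j) (yes v~j) = within u v (trans u~j (sym v~j))
    go (no  u≁j) (no  v≁j) =
      within u v (trans (sym (relabel-miss i j c _ u≁j)) (trans eq (relabel-miss i j c _ v≁j)))
    go (yes u~j) (no  v≁j) =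
      within u (tgt H e) u~j ++ʷ (reverse-walk (edge-walk e (here refl)) ++ʷ
      within (src H e) v (trans (sym (relabel-hit i j c _ u~j)) (trans eq (relabel-miss i j c _ v≁j))))
    go (no  u≁j) (yes v~j) =
      within u (src H e) (trans (sym (relabel-miss i j c _ u≁j)) (trans eq (relabel-hit i j c _ v~j))) ++ʷ
      (edge-walk e (here refl) ++ʷ within (tgt H e) v (sym v~j))

  edge⇒sameLabel : ∀ L {e} → e ∈ˡ L → label L (index (src H e)) ≡ label L (index (tgt H e))
  edge⇒sameLabel (e ∷ L) (here refl) with label L (index (src H e)) FinP.≟ label L (index (tgt H e))
  ... | yes _ = sym (relabel-hit _ _ (label L) _ refl)
  ... | no  _ = sym (relabel-hit _ _ (label L) _ refl)
  edge⇒sameLabel (f ∷ L) (there e∈L) = relabel-cong _ _ (label L) _ _ (edge⇒sameLabel L e∈L)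

  -- Membership is only required up to double negation: the labels are decidable, so
  -- this suffices, and for the edges of a clique sum nothing stronger is available.
  walk⇒sameLabel : ∀ L {P : E H → Set} → (∀ e → P e → ¬ ¬ e ∈ˡ L) →
    ∀ {u v} → EdgeWalk H P u v → label L (index u) ≡ label L (index v)
  walk⇒sameLabel L P⊆L (stay _) = refl
  walk⇒sameLabel L P⊆L {u} (step {w = w} e pe joins _ walk) with label L (index u) FinP.≟ label L (index w)
  ... | yes u~w = trans u~w (walk⇒sameLabel L P⊆L walk)
  ... | no  u≁w = ⊥-elim (P⊆L e pe (λ e∈L → u≁w (ends-sameLabel joins (edge⇒sameLabel L e∈L))))
    where
    ends-sameLabel : ∀ {x y} → Joins H e x y →
      label L (index (src H e)) ≡ label L (index (tgt H e)) → label L (index x) ≡ label L (index y)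
    ends-sameLabel (inj₁ refl) eq = eq
    ends-sameLabel (inj₂ refl) eq = sym eq

  componentCount-pos : ∀ L (v : V H) → 1 ≤ componentCount (label L)
  componentCount-pos L v = countFin-pos N _ _ (isRoot-label L v)

  sameLabel⇒≤1Component : ∀ L → (∀ u v → label L (index u) ≡ label L (index v)) → componentCount (label L) ≤ 1
  sameLabel⇒≤1Component L same = countFin-≤1 N _ roots-equal
    where
    roots-equal : ∀ k k′ → isRoot (label L) k ≡ true → isRoot (label L) k′ ≡ true → k ≡ k′
    roots-equal k k′ k-root k′-root with isRoot⁻ (label L) k k-root | isRoot⁻ (label L) k′ k′-root
    ... | occ , lk≡k | occ′ , lk′≡k′ = begin
      k                                 ≡⟨ sym lk≡k ⟩
      label L k                         ≡⟨ cong (label L) (sym (index-vertexAt k occ)) ⟩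
      label L (index (vertexAt k occ))  ≡⟨ same (vertexAt k occ) (vertexAt k′ occ′) ⟩
      label L (index (vertexAt k′ occ′)) ≡⟨ cong (label L) (index-vertexAt k′ occ′) ⟩
      label L k′                        ≡⟨ lk′≡k′ ⟩
      k′                                ∎
      where open ≡-Reasoning

  ≤1Component⇒sameLabel : ∀ L → componentCount (label L) ≤ 1 → ∀ u v → label L (index u) ≡ label L (index v)
  ≤1Component⇒sameLabel L ≤1 u v with label L (index u) FinP.≟ label L (index v)
  ... | yes u~v = u~v
  ... | no  u≁v with s≤s () ← ≤-trans (countFin-≥2 N _ _ _ (isRoot-label L u) (isRoot-label L v) u≁v) ≤1

  AcyclicList⇒merges≡length : ∀ L → AcyclicList H L → merges L ≡ length L
  AcyclicList⇒merges≡length []      _                  = refl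
  AcyclicList⇒merges≡length (e ∷ L) (unconnected , acL)
    with label L (index (src H e)) FinP.≟ label L (index (tgt H e))
  ... | yes i≡j = ⊥-elim (unconnected (sameLabel⇒walk L _ _ i≡j))
  ... | no  _   = cong suc (AcyclicList⇒merges≡length L acL)

  merges-redundant : ∀ e L → label L (index (src H e)) ≡ label L (index (tgt H e)) → merges (e ∷ L) ≡ merges L
  merges-redundant e L i≡j with label L (index (src H e)) FinP.≟ label L (index (tgt H e))
  ... | yes _   = refl
  ... | no  i≢j = ⊥-elim (i≢j i≡j)

  acyclicList-length : ∀ L → V H → AcyclicList H L → suc (length L) ≤ vertexCount
  acyclicList-length L v acL = begin
    1 + length L                         ≤⟨ +-monoˡ-≤ (length L) (componentCount-pos L v) ⟩
    componentCount (label L) + length L  ≡⟨ cong (componentCount (label L) +_) (sym (AcyclicList⇒merges≡length L acL)) ⟩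
    componentCount (label L) + merges L  ≡⟨ components+merges L ⟩
    vertexCount                          ∎
    where open ≤-Reasoning

  acyclicList-connected : ∀ L → AcyclicList H L → suc (length L) ≡ vertexCount → Connected H (_∈ˡ L)
  acyclicList-connected L acL size u v = sameLabel⇒walk L u v (≤1Component⇒sameLabel L (≤-reflexive one) u v)
    where
    one : componentCount (label L) ≡ 1
    one = +-cancelʳ-≡ (length L) _ 1 (begin
      componentCount (label L) + length L  ≡⟨ cong (componentCount (label L) +_) (sym (AcyclicList⇒merges≡length L acL)) ⟩
      componentCount (label L) + merges L  ≡⟨ components+merges L ⟩
      vertexCount                          ≡⟨ sym size ⟩
      1 + length L                         ∎)
      where open ≡-Reasoning

  connected-merges : ∀ L {P} → Connected H P → (∀ e → P e → ¬ ¬ e ∈ˡ L) → vertexCount ≤ suc (merges L)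
  connected-merges L conn P⊆L = begin
    vertexCount                          ≡⟨ sym (components+merges L) ⟩
    componentCount (label L) + merges L  ≤⟨ +-monoˡ-≤ (merges L) ≤1 ⟩
    suc (merges L)                       ∎
    where
    open ≤-Reasoning
    ≤1 = sameLabel⇒≤1Component L (λ u v → walk⇒sameLabel L P⊆L (conn u v))

  connected-length : ∀ L {P} → Connected H P → (∀ e → P e → ¬ ¬ e ∈ˡ L) → vertexCount ≤ suc (length L)
  connected-length L conn P⊆L = ≤-trans (connected-merges L conn P⊆L) (s≤s (merges≤length L))

  connected-short⇒acyclic : ∀ L {P} → Connected H P → (∀ e → P e → ¬ ¬ e ∈ˡ L) →
    suc (length L) ≤ vertexCount → Acyclic H P
  connected-short⇒acyclic L {P} conn P⊆L short e pe cycle = P⊆L e pe e∉L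
    where
    e∉L : ¬ e ∈ˡ L
    e∉L e∈L with extract L e∈L
    ... | r , L⊆e∷r , len with label r (index (src H e)) FinP.≟ label r (index (tgt H e))
    ... | no  apart = apart (walk⇒sameLabel r P∖e⊆r cycle)
      where
      P∖e⊆r : ∀ x → P x × x ≢ e → ¬ ¬ x ∈ˡ r
      P∖e⊆r x (px , x≢e) x∉r = P⊆L x px λ x∈L → case (L⊆e∷r x∈L)
        where
        case : x ∈ˡ e ∷ r → ⊥
        case (here x≡e)  = x≢e x≡e
        case (there x∈r) = x∉r x∈r
    ... | yes together = <-irrefl refl (begin-strict
      vertexCount         ≤⟨ connected-merges (e ∷ r) conn (λ x px x∉e∷r → P⊆L x px (λ x∈L → x∉e∷r (L⊆e∷r x∈L))) ⟩
      suc (merges (e ∷ r)) ≡⟨ cong suc (merges-redundant e r together) ⟩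
      suc (merges r)      ≤⟨ s≤s (merges≤length r) ⟩
      suc (length r)      ≡⟨ sym len ⟩
      length L            <⟨ short ⟩
      vertexCount         ∎)
      where open ≤-Reasoning

  spanningTree-length : ∀ L {P} → V H → Connected H P → Acyclic H P → Unique L →
    (∀ {x} → x ∈ˡ L → P x) → (∀ e → P e → ¬ ¬ e ∈ˡ L) → suc (length L) ≡ vertexCount
  spanningTree-length L v conn acyclic unique L⊆P P⊆L = ≤-antisym
    (acyclicList-length L v (Acyclic⇒AcyclicList H L unique L⊆P acyclic))
    (connected-length L conn P⊆L)

private
  +-suc² : ∀ a b → a + suc (suc b) ≡ suc (suc (a + b))
  +-suc² a b = trans (+-suc a (suc b)) (cong suc (+-suc a b))

double-vertexCount : ∀ {K m₁ m₂ n₁ n₂} → suc (suc m₁) ≡ n₁ + n₁ → suc (suc m₂) ≡ n₂ + n₂ →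
  suc (suc K) ≡ n₁ + n₂ → K + K ≡ m₁ + m₂
double-vertexCount {K} {m₁} {m₂} {n₁} {n₂} edges₁ edges₂ vertices = +-cancelˡ-≡ 4 _ _ (begin
  4 + (K + K)                     ≡⟨ cong (suc ∘ suc) (sym (+-suc² K K)) ⟩
  suc (suc K) + suc (suc K)       ≡⟨ cong₂ _+_ vertices vertices ⟩
  (n₁ + n₂) + (n₁ + n₂)           ≡⟨ interchange n₁ n₂ n₁ n₂ ⟩
  (n₁ + n₁) + (n₂ + n₂)           ≡⟨ cong₂ _+_ (sym edges₁) (sym edges₂) ⟩
  suc (suc m₁) + suc (suc m₂)     ≡⟨ cong (suc ∘ suc) (+-suc² m₁ m₂) ⟩
  4 + (m₁ + m₂)                   ∎)
  where open ≡-Reasoning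

forced-split : ∀ {s t m n} → suc s ≤ n → suc t ≤ n → suc (s + t) ≡ m → suc (suc m) ≡ n + n →
  ((suc s ≡ n) × (suc (suc t) ≡ n)) ⊎ ((suc (suc s) ≡ n) × (suc t ≡ n))
forced-split {s} {t} {m} {n} s<n t<n size edges
  with x , sx ← m≤n⇒∃[o]m+o≡n s<n | y , ty ← m≤n⇒∃[o]m+o≡n t<n = split x y slack sx ty
  where
  slack : x + y ≡ 1
  slack = +-cancelˡ-≡ (suc (suc (s + t))) _ _ (begin
    suc (suc (s + t)) + (x + y)    ≡⟨ cong (λ k → suc k + (x + y)) (sym (+-suc s t)) ⟩
    (suc s + suc t) + (x + y)      ≡⟨ interchange (suc s) (suc t) x y ⟩
    (suc s + x) + (suc t + y)      ≡⟨ cong₂ _+_ sx ty ⟩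
    n + n                          ≡⟨ sym edges ⟩
    suc (suc m)                    ≡⟨ cong (suc ∘ suc) (sym size) ⟩
    suc (suc (suc (s + t)))        ≡⟨ +-comm 1 _ ⟩
    suc (suc (s + t)) + 1          ∎)
    where open ≡-Reasoning
  split : ∀ x y → x + y ≡ 1 → suc s + x ≡ n → suc t + y ≡ n →
    ((suc s ≡ n) × (suc (suc t) ≡ n)) ⊎ ((suc (suc s) ≡ n) × (suc t ≡ n))
  split 0 1 _ sx ty = inj₁ (trans (sym (+-identityʳ (suc s))) sx , trans (+-comm 1 (suc t)) ty)
  split 1 0 _ sx ty = inj₂ (trans (+-comm 1 (suc s)) sx , trans (sym (+-identityʳ (suc t))) ty)
  split 0 0 ()
  split (suc (suc x)) y ()
  split (suc zero) (suc y) ()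

-- K, n₁, n₂ are the vertex counts of G, G₁, G₂, and cᵢ, sᵢ count the edges in Eᵢ ∖ {dᵢ}
-- of a spanning tree of G.
module _ {K n₁ n₂ : ℕ} (vertices : suc (suc K) ≡ n₁ + n₂) where

  glue-count₁ : ∀ {c₁ c₂} → suc (suc c₁) ≡ n₁ → suc c₂ ≡ n₂ → suc (c₁ + c₂) ≡ K
  glue-count₁ {c₁} {c₂} refl refl =
    suc-injective (suc-injective (trans (cong (suc ∘ suc) (sym (+-suc c₁ c₂))) (sym vertices)))

  glue-count₂ : ∀ {c₁ c₂} → suc c₁ ≡ n₁ → suc (suc c₂) ≡ n₂ → suc (c₁ + c₂) ≡ K
  glue-count₂ {c₁} {c₂} refl refl =
    suc-injective (suc-injective (trans (cong suc (sym (+-suc² c₁ c₂))) (sym vertices)))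

  split-count₁ : ∀ {s₁ s₂} → suc (s₁ + s₂) ≡ K → suc s₁ ≡ n₁ → suc (suc s₂) ≡ n₂
  split-count₁ {s₁} {s₂} refl refl = +-cancelˡ-≡ (suc s₁) _ _ (trans (cong suc (+-suc² s₁ s₂)) vertices)

  split-count₂ : ∀ {s₁ s₂} → suc (s₁ + s₂) ≡ K → suc (suc s₁) ≡ n₁ → suc s₂ ≡ n₂
  split-count₂ {s₁} {s₂} refl refl = +-cancelˡ-≡ (suc (suc s₁)) _ _ (trans (cong (suc ∘ suc) (+-suc s₁ s₂)) vertices)

≡ᵇ-∸2-true : ∀ {c n} → suc (suc c) ≡ n → (c ≡ᵇ (n ∸ 2)) ≡ true
≡ᵇ-∸2-true {c} refl = dec-true (c ≟ c) refl

≡ᵇ-∸2-false : ∀ {c n} → suc c ≡ n → 2 ≤ n → (c ≡ᵇ (n ∸ 2)) ≡ false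
≡ᵇ-∸2-false {suc c} refl _ = dec-false (suc c ≟ c) 1+n≢n
≡ᵇ-∸2-false {zero} refl (s≤s ())

-- The 2-clique sum

true≢false : true ≢ false
true≢false ()

to-injective : {A : Set} {n : ℕ} (f : A ↔ Fin n) → ∀ {x y} → Inverse.to f x ≡ Inverse.to f y → x ≡ y
to-injective f = Injection.injective (↔⇒↣ f)

module CliqueSum (G₁ G₂ : Graph) (F₁ : Finite G₁) (F₂ : Finite G₂) (d₁ : E G₁) (d₂ : E G₂)
                 (simple₁ : Simple G₁) (simple₂ : Simple G₂) where

  G : Graph
  G = cliqueSum G₁ G₂ F₂ d₁ d₂

  glue′ : Subset (E G₁) → Subset (E G₂) → Subset (E G)
  glue′ = glue G₁ G₂ F₁ F₂ d₁ d₂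

  restrict₁′ side₁′ : Subset (E G) → Subset (E G₁)
  restrict₁′ = restrict₁ G₁ G₂ F₁ F₂ d₁ d₂
  side₁′     = side₁ G₁ G₂ F₁ F₂ d₁ d₂

  restrict₂′ side₂′ : Subset (E G) → Subset (E G₂)
  restrict₂′ = restrict₂ G₁ G₂ F₁ F₂ d₁ d₂
  side₂′     = side₂ G₁ G₂ F₁ F₂ d₁ d₂

  ι : V G₂ → V G
  ι = ι₂ G₁ G₂ F₂ d₁ d₂

  u₀ u₁ : V G
  u₀ = inj₁ (src G₁ d₁)
  u₁ = inj₁ (tgt G₁ d₁)

  ι-src : ι (src G₂ d₂) ≡ u₀
  ι-src with ↔-decEq (V↔ F₂) (src G₂ d₂) (src G₂ d₂)
  ... | yes _ = refl
  ... | no  n = ⊥-elim (n refl)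

  ι-tgt : ι (tgt G₂ d₂) ≡ u₁
  ι-tgt with ↔-decEq (V↔ F₂) (tgt G₂ d₂) (src G₂ d₂)
  ... | yes e = ⊥-elim (proj₁ simple₂ d₂ (sym e))
  ... | no  _ with ↔-decEq (V↔ F₂) (tgt G₂ d₂) (tgt G₂ d₂)
  ...   | yes _ = refl
  ...   | no  n = ⊥-elim (n refl)

  ι-inner : ∀ x {v p q} → ι x ≡ inj₂ (v , p , q) → x ≡ v
  ι-inner x eq with ↔-decEq (V↔ F₂) x (src G₂ d₂)
  ι-inner x () | yes _
  ... | no _ with ↔-decEq (V↔ F₂) x (tgt G₂ d₂)
  ι-inner x ()   | no _ | yes _
  ι-inner x refl | no _ | no _ = refl

  ι-inner-fixed : ∀ x {v p q} → ι x ≡ inj₂ (v , p , q) → ι v ≡ inj₂ (v , p , q)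
  ι-inner-fixed x eq = subst (λ y → ι y ≡ _) (ι-inner x eq) eq

  -- The vertex inj₂ (v , p , q) of G does not determine the proofs p, q, so ι v need not
  -- return it; an incident edge, which exists in a connected spanning subgraph, shows it does.
  ι-canonical : ∀ {P} → Connected G P → ∀ v p q → ι v ≡ inj₂ (v , p , q)
  ι-canonical conn v p q with conn (inj₂ (v , p , q)) u₀
  ... | step (inj₁ _) _ (inj₁ ()) _ _
  ... | step (inj₁ _) _ (inj₂ ()) _ _
  ... | step (inj₂ (f , _)) _ (inj₁ eq) _ _ = ι-inner-fixed (src G₂ f) (cong proj₁ eq)
  ... | step (inj₂ (f , _)) _ (inj₂ eq) _ _ = ι-inner-fixed (tgt G₂ f) (cong proj₂ eq)

  module VertexIndexing {P : E G → Set} (conn : Connected G P) where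
    private
      n₁ = nV F₁
      n₂ = nV F₂
      to₁ = Inverse.to (V↔ F₁)
      to₂ = Inverse.to (V↔ F₂)
      a = to₂ (src G₂ d₂)
      b = to₂ (tgt G₂ d₂)

    avoids : Fin n₂ → Fin n₂ → Bool
    avoids c j = not (does (j FinP.≟ c))

    avoids-≢ : ∀ {c j} → j ≢ c → avoids c j ≡ true
    avoids-≢ {c} {j} j≢c = cong not (dec-false (j FinP.≟ c) j≢c)

    ≢-avoids : ∀ {c j} → avoids c j ≡ true → j ≢ c
    ≢-avoids {c} {j} avoid with j FinP.≟ c
    ≢-avoids () | yes _
    ... | no j≢c = j≢c

    occupiedSplit : Fin n₁ ⊎ Fin n₂ → Bool
    occupiedSplit (inj₁ _) = true
    occupiedSplit (inj₂ j) = avoids a j ∧ avoids b j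

    index : V G → Fin (n₁ + n₂)
    index (inj₁ u)       = to₁ u ↑ˡ n₂
    index (inj₂ (v , _)) = n₁ ↑ʳ to₂ v

    ≢-from₂ : ∀ j x → j ≢ to₂ x → Inverse.from (V↔ F₂) j ≢ x
    ≢-from₂ j x j≢ e = j≢ (trans (sym (Inverse.strictlyInverseˡ (V↔ F₂) j)) (cong to₂ e))

    ∧-trueˡ : ∀ x {y} → x ∧ y ≡ true → x ≡ true
    ∧-trueˡ true _ = refl

    ∧-trueʳ : ∀ x {y} → x ∧ y ≡ true → y ≡ true
    ∧-trueʳ true xy = xy

    vertexAtSplit : (s : Fin n₁ ⊎ Fin n₂) → occupiedSplit s ≡ true → V G
    vertexAtSplit (inj₁ i) _   = inj₁ (Inverse.from (V↔ F₁) i)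
    vertexAtSplit (inj₂ j) occ = inj₂ (Inverse.from (V↔ F₂) j ,
      ≢-from₂ j _ (≢-avoids (∧-trueˡ (avoids a j) occ)) , ≢-from₂ j _ (≢-avoids (∧-trueʳ (avoids a j) occ)))

    index-vertexAtSplit : ∀ s occ → index (vertexAtSplit s occ) ≡ join n₁ n₂ s
    index-vertexAtSplit (inj₁ i) _ = cong (_↑ˡ n₂) (Inverse.strictlyInverseˡ (V↔ F₁) i)
    index-vertexAtSplit (inj₂ j) _ = cong (n₁ ↑ʳ_) (Inverse.strictlyInverseˡ (V↔ F₂) j)

    occupied-index : ∀ v → occupiedSplit (splitAt n₁ (index v)) ≡ true
    occupied-index (inj₁ u) rewrite FinP.splitAt-↑ˡ n₁ (to₁ u) n₂ = refl
    occupied-index (inj₂ (v , p , q)) rewrite FinP.splitAt-↑ʳ n₁ n₂ (to₂ v)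
                                            | avoids-≢ (λ e → p (to-injective (V↔ F₂) e))
                                            | avoids-≢ (λ e → q (to-injective (V↔ F₂) e)) = refl

    index-injective : ∀ u v → index u ≡ index v → u ≡ v
    index-injective (inj₁ u) (inj₁ v) e = cong inj₁ (to-injective (V↔ F₁) (FinP.↑ˡ-injective n₂ _ _ e))
    index-injective (inj₁ u) (inj₂ v) e with () ←
      trans (sym (FinP.splitAt-↑ˡ n₁ (to₁ u) n₂)) (trans (cong (splitAt n₁) e) (FinP.splitAt-↑ʳ n₁ n₂ _))
    index-injective (inj₂ u) (inj₁ v) e with () ←
      trans (sym (FinP.splitAt-↑ˡ n₁ (to₁ v) n₂)) (trans (cong (splitAt n₁) (sym e)) (FinP.splitAt-↑ʳ n₁ n₂ _))
    index-injective (inj₂ (u , p , q)) (inj₂ (v , p′ , q′)) e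
      with refl ← to-injective (V↔ F₂) (FinP.↑ʳ-injective n₁ _ _ e) =
      trans (sym (ι-canonical conn u p q)) (ι-canonical conn u p′ q′)

    indexing : Indexing G
    indexing = record
      { N               = n₁ + n₂
      ; index           = index
      ; occupied        = occupiedSplit ∘ splitAt n₁
      ; occupied-index  = occupied-index
      ; vertexAt        = vertexAtSplit ∘ splitAt n₁
      ; index-vertexAt  = λ k occ → trans (index-vertexAtSplit (splitAt n₁ k) occ) (FinP.join-splitAt n₁ n₂ k)
      ; index-injective = index-injective
      }

    vertexCount-cliqueSum : suc (suc (Indexing.vertexCount indexing)) ≡ n₁ + n₂
    vertexCount-cliqueSum = begin
      2 + countFin (n₁ + n₂) (occupiedSplit ∘ splitAt n₁)
        ≡⟨ cong (2 +_) (countFin-↑ n₁ n₂ _) ⟩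
      2 + (countFin n₁ (occupiedSplit ∘ splitAt n₁ ∘ (_↑ˡ n₂)) + countFin n₂ (occupiedSplit ∘ splitAt n₁ ∘ (n₁ ↑ʳ_)))
        ≡⟨ cong (λ k → 2 + k) (cong₂ _+_ first second) ⟩
      2 + (n₁ + countFin n₂ (λ j → avoids a j ∧ avoids b j))
        ≡⟨ sym (trans (+-suc n₁ _) (cong suc (+-suc n₁ _))) ⟩
      n₁ + (2 + countFin n₂ (λ j → avoids a j ∧ avoids b j))
        ≡⟨ cong (n₁ +_) two-removed ⟩
      n₁ + n₂
        ∎
      where
      open ≡-Reasoning
      first : countFin n₁ (occupiedSplit ∘ splitAt n₁ ∘ (_↑ˡ n₂)) ≡ n₁
      first = countFin-true n₁ (λ i → cong occupiedSplit (FinP.splitAt-↑ˡ n₁ i n₂))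
      second : countFin n₂ (occupiedSplit ∘ splitAt n₁ ∘ (n₁ ↑ʳ_)) ≡ countFin n₂ (λ j → avoids a j ∧ avoids b j)
      second = countFin-cong n₂ (λ j → cong occupiedSplit (FinP.splitAt-↑ʳ n₁ n₂ j))
      a≢b : a ≢ b
      a≢b e = proj₁ simple₂ d₂ (to-injective (V↔ F₂) e)
      self : ∀ c → avoids c c ≡ false
      self c = cong not (dec-true (c FinP.≟ c) refl)
      a-removed : suc (countFin n₂ (avoids a)) ≡ n₂
      a-removed = trans (countFin-remove n₂ (λ _ → true) (avoids a) a refl (self a) (λ k k≢a → avoids-≢ k≢a))
                        (countFin-true n₂ (λ _ → refl))
      two-removed : suc (suc (countFin n₂ (λ j → avoids a j ∧ avoids b j))) ≡ n₂
      two-removed = trans (cong suc (countFin-remove n₂ (avoids a) (λ j → avoids a j ∧ avoids b j) b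
          (avoids-≢ (λ b≡a → a≢b (sym b≡a)))
          (trans (cong (avoids a b ∧_) (self b)) (∧-zeroʳ (avoids a b)))
          (λ k k≢b → trans (cong (avoids a k ∧_) (avoids-≢ k≢b)) (∧-identityʳ (avoids a k)))))
        a-removed

  -- Gᵢ with its embedding into G, mapping the ends of dᵢ to u₀, u₁; both summands are
  -- handled through this interface.
  record Summand : Set₁ where
    field
      graph          : Graph
      finite         : Finite graph
      virtual        : E graph
      simple         : Simple graph
      vmap           : V graph → V G
      emap           : (f : E graph) → f ≢ virtual → E G
      emap-ends      : ∀ f p → ends G (emap f p) ≡ (vmap (src graph f) , vmap (tgt graph f))
      vmap-src       : vmap (src graph virtual) ≡ u₀
      vmap-tgt       : vmap (tgt graph virtual) ≡ u₁
      emap-injective : ∀ f p f′ p′ → emap f p ≡ emap f′ p′ → f ≡ f′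
      restrict       : Subset (E G) → Subset (E graph)
      -- emap? f fixes one proof of f ≢ virtual, so restrict A f ≡ A (emap f p) with p independent of A.
      emap?          : E graph → Maybe (E G)
      restrict-emap? : ∀ A f → maybe′ A false (emap? f) ≡ restrict A f
      emap?-virtual  : emap? virtual ≡ nothing
      emap?-real     : ∀ f → f ≢ virtual → Σ (f ≢ virtual) (λ p → emap? f ≡ just (emap f p))
      emap?-just     : ∀ f x → emap? f ≡ just x → Σ (f ≢ virtual) (λ p → x ≡ emap f p)
      side           : Subset (E G) → Subset (E graph)
      side-real      : ∀ A f → f ≢ virtual → side A f ≡ restrict A f
      side-virtual   : ∀ A → side A virtual ≡
                         (countFin (nE finite) (restrict A ∘ Inverse.from (E↔ finite)) ≡ᵇ (nV finite ∸ 2))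

  module OnSummand (Sᵢ : Summand) where
    open Summand Sᵢ

    nᵢ mᵢ : ℕ
    nᵢ = nV finite
    mᵢ = nE finite

    fromE : Fin mᵢ → E graph
    fromE = Inverse.from (E↔ finite)

    toE : E graph → Fin mᵢ
    toE = Inverse.to (E↔ finite)

    fromE-toE : ∀ f → fromE (toE f) ≡ f
    fromE-toE = Inverse.strictlyInverseʳ (E↔ finite)

    fromE-≢ : ∀ k → k ≢ toE virtual → fromE k ≢ virtual
    fromE-≢ k k≢ e = k≢ (trans (sym (Inverse.strictlyInverseˡ (E↔ finite) k)) (cong toE e))

    fromE-injective : ∀ i j → fromE i ≡ fromE j → i ≡ j
    fromE-injective i j e = trans (sym (Inverse.strictlyInverseˡ (E↔ finite) i))
                                  (trans (cong toE e) (Inverse.strictlyInverseˡ (E↔ finite) j))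

    indexing : Indexing graph
    indexing = record
      { N = nᵢ ; index = Inverse.to (V↔ finite) ; occupied = λ _ → true ; occupied-index = λ _ → refl
      ; vertexAt = λ k _ → Inverse.from (V↔ finite) k
      ; index-vertexAt = λ k _ → Inverse.strictlyInverseˡ (V↔ finite) k
      ; index-injective = λ _ _ → to-injective (V↔ finite) }

    module C = Components graph indexing

    vertexCount≡nᵢ : Indexing.vertexCount indexing ≡ nᵢ
    vertexCount≡nᵢ = countFin-true nᵢ (λ _ → refl)

    restrict-virtual : ∀ A → restrict A virtual ≡ false
    restrict-virtual A = trans (sym (restrict-emap? A virtual)) (cong (maybe′ A false) emap?-virtual)

    restrict-real : ∀ f → f ≢ virtual → Σ (f ≢ virtual) (λ p → ∀ A → restrict A f ≡ A (emap f p))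
    restrict-real f f≢d with emap?-real f f≢d
    ... | p , eq = p , λ A → trans (sym (restrict-emap? A f)) (cong (maybe′ A false) eq)

    restrict⇒real : ∀ A f → f ∈ restrict A → f ≢ virtual
    restrict⇒real A f f∈ refl with () ← trans (sym f∈) (restrict-virtual A)

    lift-walk : {P : E graph → Set} {Q : E G → Set} →
      (∀ f → P f → f ≢ virtual → Σ (f ≢ virtual) (λ p → Q (emap f p))) →
      (P virtual → EdgeWalk G Q u₀ u₁) →
      ∀ {u v} → EdgeWalk graph P u v → EdgeWalk G Q (vmap u) (vmap v)
    lift-walk {P} {Q} real virtual-bridge = map-walk-across graph G vmap image
      where
      image : ∀ e → P e → EdgeWalk G Q (vmap (src graph e)) (vmap (tgt graph e))
      image e pe with ↔-decEq (E↔ finite) e virtual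
      ... | yes refl = cast-walk (sym vmap-src) (sym vmap-tgt) (virtual-bridge pe)
      ... | no  e≢d with real e pe e≢d
      ...   | p , q = step (emap e p) q (inj₁ (emap-ends e p)) refl (stay refl)

    lift-cycle : ∀ {A : Subset (E G)} {P : E graph → Set} e p →
      (∀ f → P f → f ≢ virtual → Σ (f ≢ virtual) (λ p′ → (emap f p′ ∈ A) × (emap f p′ ≢ emap e p))) →
      (P virtual → EdgeWalk G (λ z → z ∈ A × z ≢ emap e p) u₀ u₁) →
      EdgeWalk graph P (src graph e) (tgt graph e) →
      EdgeWalk G (λ z → z ∈ A × z ≢ emap e p) (src G (emap e p)) (tgt G (emap e p))
    lift-cycle e p real virtual-bridge w =
      cast-walk (sym (cong proj₁ (emap-ends e p))) (sym (cong proj₂ (emap-ends e p)))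
        (lift-walk real virtual-bridge w)

    restrict-acyclic : ∀ A → Acyclic G (_∈ A) → Acyclic graph (_∈ restrict A)
    restrict-acyclic A acyclic e e∈ cycle with restrict-real e (restrict⇒real A e e∈)
    ... | p , restrict≡ = acyclic (emap e p) (trans (sym (restrict≡ A)) e∈)
          (lift-cycle e p real (λ (d∈ , _) → ⊥-elim (restrict⇒real A virtual d∈ refl)) cycle)
      where
      real : ∀ f → f ∈ restrict A × f ≢ e → f ≢ virtual →
        Σ (f ≢ virtual) (λ p′ → (emap f p′ ∈ A) × (emap f p′ ≢ emap e p))
      real f (f∈ , f≢e) f≢d with restrict-real f f≢d
      ... | p′ , restrict≡′ = p′ , trans (sym (restrict≡′ A)) f∈ , (λ eq → f≢e (emap-injective f p′ e p eq))

    restrictCount : Subset (E G) → ℕ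
    restrictCount A = countFin mᵢ (restrict A ∘ fromE)

    edgeList : Subset (E graph) → List (E graph)
    edgeList S = collect mᵢ (just ∘ fromE) S

    length-edgeList : ∀ S → length (edgeList S) ≡ countFin mᵢ (S ∘ fromE)
    length-edgeList S = length-collect mᵢ _ S

    edgeList-unique : ∀ S → Unique (edgeList S)
    edgeList-unique S = collect-unique mᵢ _ S (λ i j hi hj → fromE-injective i j (just-injective (trans hi (sym hj))))

    ∈-edgeList⁻ : ∀ S {f} → f ∈ˡ edgeList S → f ∈ S
    ∈-edgeList⁻ S f∈ with ∈-collect⁻ mᵢ _ S f∈
    ... | (i , refl) , f∈S = f∈S

    ∈-edgeList⁺ : ∀ S {f} → f ∈ S → f ∈ˡ edgeList S
    ∈-edgeList⁺ S {f} f∈S = ∈-collect⁺ mᵢ _ S (toE f) (cong just (fromE-toE f)) f∈S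

    edgeList-covers : ∀ S f → f ∈ S → ¬ ¬ f ∈ˡ edgeList S
    edgeList-covers S f f∈S f∉ = f∉ (∈-edgeList⁺ S f∈S)

    restrict-edgeList-acyclic : ∀ A → Acyclic G (_∈ A) → AcyclicList graph (edgeList (restrict A))
    restrict-edgeList-acyclic A acyclic = Acyclic⇒AcyclicList graph _ (edgeList-unique (restrict A))
      (∈-edgeList⁻ (restrict A)) (restrict-acyclic A acyclic)

    restrict-size : ∀ A → Acyclic G (_∈ A) → suc (restrictCount A) ≤ nᵢ
    restrict-size A acyclic = subst₂ _≤_ (cong suc (length-edgeList (restrict A))) vertexCount≡nᵢ
      (C.acyclicList-length _ (src graph virtual) (restrict-edgeList-acyclic A acyclic))

    restrict-connected : ∀ A → Acyclic G (_∈ A) → suc (restrictCount A) ≡ nᵢ → Connected graph (_∈ restrict A)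
    restrict-connected A acyclic size u v = map-walk (λ _ → ∈-edgeList⁻ (restrict A))
      (C.acyclicList-connected _ (restrict-edgeList-acyclic A acyclic)
        (trans (cong suc (length-edgeList (restrict A))) (trans size (sym vertexCount≡nᵢ))) u v)

    bridge : ∀ A → Acyclic G (_∈ A) → suc (restrictCount A) ≡ nᵢ → {Q : E G → Set} →
      (∀ f → f ∈ restrict A → f ≢ virtual → Σ (f ≢ virtual) (λ p → Q (emap f p))) → EdgeWalk G Q u₀ u₁
    bridge A acyclic size real = cast-walk vmap-src vmap-tgt
      (lift-walk real (λ d∈ → ⊥-elim (restrict⇒real A virtual d∈ refl))
        (restrict-connected A acyclic size (src graph virtual) (tgt graph virtual)))

    treeCount : Subset (E graph) → ℕ
    treeCount S = countFin mᵢ (S ∘ fromE)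

    spanningTree-count : ∀ S → SpanningTree graph S → suc (treeCount S) ≡ nᵢ
    spanningTree-count S tree = trans (cong suc (sym (length-edgeList S)))
      (trans (C.spanningTree-length (edgeList S) (src graph virtual) (spanningTree-connected tree) (proj₂ tree)
               (edgeList-unique S) (∈-edgeList⁻ S) (edgeList-covers S))
             vertexCount≡nᵢ)

    two-vertices : 2 ≤ nᵢ
    two-vertices = subst (2 ≤_) vertexCount≡nᵢ (countFin-≥2 nᵢ _ _ _ refl refl
      (λ e → proj₁ simple virtual (to-injective (V↔ finite) e)))

    side-full : ∀ A → Acyclic G (_∈ A) → suc (restrictCount A) ≡ nᵢ →
      (side A virtual ≡ false) × SpanningTree graph (side A)
    side-full A acyclic size = virtual-out , spanningTree conn
      (C.connected-short⇒acyclic (edgeList (restrict A)) conn covers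
        (≤-reflexive (trans (cong suc (length-edgeList (restrict A))) (trans size (sym vertexCount≡nᵢ)))))
      where
      virtual-out : side A virtual ≡ false
      virtual-out = trans (side-virtual A) (≡ᵇ-∸2-false size two-vertices)
      side≗restrict : ∀ f → side A f ≡ restrict A f
      side≗restrict f with ↔-decEq (E↔ finite) f virtual
      ... | yes refl = trans virtual-out (sym (restrict-virtual A))
      ... | no  f≢d  = side-real A f f≢d
      conn : Connected graph (_∈ side A)
      conn u v = map-walk (λ f f∈ → trans (side≗restrict f) f∈) (restrict-connected A acyclic size u v)
      covers : ∀ f → f ∈ side A → ¬ ¬ f ∈ˡ edgeList (restrict A)
      covers f f∈ = edgeList-covers (restrict A) f (trans (sym (side≗restrict f)) f∈)

    -- A cycle of side A through a real edge e may use the virtual edge; replacing it by the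
    -- bridge, which runs outside the image of this summand, gives a cycle of A through emap e.
    side-acyclic-off-virtual : ∀ A → Acyclic G (_∈ A) →
      EdgeWalk G (λ z → z ∈ A × (∀ f p → z ≢ emap f p)) u₀ u₁ →
      ∀ e → e ∈ side A → e ≢ virtual → ¬ EdgeWalk graph (λ x → x ∈ side A × x ≢ e) (src graph e) (tgt graph e)
    side-acyclic-off-virtual A acyclic outside e e∈ e≢d cycle with restrict-real e e≢d
    ... | p , restrict≡ = acyclic (emap e p) (trans (sym (restrict≡ A)) (trans (sym (side-real A e e≢d)) e∈))
          (lift-cycle e p real (λ _ → map-walk (λ z (z∈ , outside-z) → z∈ , outside-z e p) outside) cycle)
      where
      real : ∀ f → f ∈ side A × f ≢ e → f ≢ virtual →
        Σ (f ≢ virtual) (λ p′ → (emap f p′ ∈ A) × (emap f p′ ≢ emap e p))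
      real f (f∈ , f≢e) f≢d with restrict-real f f≢d
      ... | p′ , restrict≡′ = p′ , trans (sym (restrict≡′ A)) (trans (sym (side-real A f f≢d)) f∈) ,
                              (λ eq → f≢e (emap-injective f p′ e p eq))

    side-added : ∀ A → Acyclic G (_∈ A) → suc (suc (restrictCount A)) ≡ nᵢ →
      EdgeWalk G (λ z → z ∈ A × (∀ f p → z ≢ emap f p)) u₀ u₁ →
      (side A virtual ≡ true) × SpanningTree graph (side A)
    side-added A acyclic size outside = virtual-in , spanningTree conn
      (C.connected-short⇒acyclic L conn covers (≤-reflexive (trans lengthL (trans size (sym vertexCount≡nᵢ)))))
      where
      virtual-in : side A virtual ≡ true
      virtual-in = trans (side-virtual A) (≡ᵇ-∸2-true size)
      L : List (E graph)
      L = edgeList (restrict A) ++ virtual ∷ []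
      lengthL : suc (length L) ≡ suc (suc (restrictCount A))
      lengthL = cong suc (trans (length-++ (edgeList (restrict A)))
                                (trans (+-comm _ 1) (cong suc (length-edgeList (restrict A)))))
      L-unique : Unique L
      L-unique = ++⁺ (edgeList-unique (restrict A)) ([] ∷ [])
        (λ { (d∈ , here refl) → restrict⇒real A virtual (∈-edgeList⁻ (restrict A) d∈) refl })
      L⊆side : ∀ {x} → x ∈ˡ L → x ∈ side A
      L⊆side {x} x∈ with ∈-++⁻ (edgeList (restrict A)) x∈
      ... | inj₁ x∈′        = let x∈r = ∈-edgeList⁻ (restrict A) x∈′ in
                              trans (side-real A x (restrict⇒real A x x∈r)) x∈r
      ... | inj₂ (here refl) = virtual-in
      conn : Connected graph (_∈ side A)
      conn u v = map-walk (λ _ → L⊆side) (C.acyclicList-connected L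
        (AcyclicList-snoc graph _ virtual L-unique L⊆side (side-acyclic-off-virtual A acyclic outside)
          (proj₁ simple virtual))
        (trans lengthL (trans size (sym vertexCount≡nᵢ))) u v)
      covers : ∀ f → f ∈ side A → ¬ ¬ f ∈ˡ L
      covers f f∈ f∉ with ↔-decEq (E↔ finite) f virtual
      ... | yes refl = f∉ (∈-++⁺ʳ (edgeList (restrict A)) (here refl))
      ... | no  f≢d  = f∉ (∈-++⁺ˡ (∈-edgeList⁺ (restrict A) (trans (sym (side-real A f f≢d)) f∈)))

    module Glued (Aᵢ : Subset (E graph)) (B : Subset (E G)) (B-emap : ∀ f p → B (emap f p) ≡ Aᵢ f) where

      restrict-glued : ∀ f → f ≢ virtual → restrict B f ≡ Aᵢ f
      restrict-glued f f≢d with restrict-real f f≢d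
      ... | p , restrict≡ = trans (restrict≡ B) (B-emap f p)

      restrictCount-in : Aᵢ virtual ≡ true → suc (restrictCount B) ≡ treeCount Aᵢ
      restrictCount-in d∈ = countFin-remove mᵢ _ _ (toE virtual)
        (trans (cong Aᵢ (fromE-toE virtual)) d∈) (trans (cong (restrict B) (fromE-toE virtual)) (restrict-virtual B))
        (λ k k≢ → restrict-glued (fromE k) (fromE-≢ k k≢))

      restrictCount-out : Aᵢ virtual ≡ false → restrictCount B ≡ treeCount Aᵢ
      restrictCount-out d∉ = countFin-cong mᵢ agree
        where
        agree : ∀ k → restrict B (fromE k) ≡ Aᵢ (fromE k)
        agree k with ↔-decEq (E↔ finite) (fromE k) virtual
        ... | yes e   = trans (cong (restrict B) e) (trans (restrict-virtual B) (trans (sym d∉) (cong Aᵢ (sym e))))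
        ... | no  k≢d = restrict-glued (fromE k) k≢d

      lift-glued : (Aᵢ virtual ≡ true → EdgeWalk G (_∈ B) u₀ u₁) →
        ∀ {u v} → EdgeWalk graph (_∈ Aᵢ) u v → EdgeWalk G (_∈ B) (vmap u) (vmap v)
      lift-glued = lift-walk (λ f f∈ f≢d → f≢d , trans (B-emap f f≢d) f∈)

      side-glued : SpanningTree graph Aᵢ → ∀ e → side B e ≡ Aᵢ e
      side-glued tree e with ↔-decEq (E↔ finite) e virtual
      ... | no  e≢d  = trans (side-real B e e≢d) (restrict-glued e e≢d)
      ... | yes refl with Aᵢ virtual in d∈
      ...   | true  = trans (side-virtual B)
                        (≡ᵇ-∸2-true (trans (cong suc (restrictCount-in d∈)) (spanningTree-count Aᵢ tree)))
      ...   | false = trans (side-virtual B)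
                        (≡ᵇ-∸2-false (trans (cong suc (restrictCount-out d∈)) (spanningTree-count Aᵢ tree))
                                     two-vertices)

    edgeCount : Bispanning graph → suc (suc mᵢ) ≡ nᵢ + nᵢ
    edgeCount ((S , T) , pair) = begin
      suc (suc mᵢ)
        ≡⟨ cong (suc ∘ suc) (sym (countFin-complement mᵢ _ _ (treePair-complement pair ∘ fromE))) ⟩
      suc (suc (treeCount S + treeCount T))       ≡⟨ cong suc (sym (+-suc (treeCount S) _)) ⟩
      suc (treeCount S) + suc (treeCount T)       ≡⟨ cong₂ _+_ (spanningTree-count S (treePair-left pair))
                                                                (spanningTree-count T (treePair-right pair)) ⟩
      nᵢ + nᵢ                                     ∎
      where open ≡-Reasoning

    restrictCount-all : suc (restrictCount (λ _ → true)) ≡ mᵢ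
    restrictCount-all = trans (Glued.restrictCount-in (λ _ → true) (λ _ → true) (λ _ _ → refl) refl)
                              (countFin-true mᵢ (λ _ → refl))

    restrictCount-complement : ∀ S T → (∀ y → S y ≡ not (T y)) → suc (restrictCount S + restrictCount T) ≡ mᵢ
    restrictCount-complement S T S≗¬T = countFin-complement-except mᵢ _ _ (toE virtual)
      (trans (cong (restrict S) (fromE-toE virtual)) (restrict-virtual S))
      (trans (cong (restrict T) (fromE-toE virtual)) (restrict-virtual T))
      (λ k k≢ → complement-real (fromE k) (fromE-≢ k k≢))
      where
      complement-real : ∀ f → f ≢ virtual → restrict S f ≡ not (restrict T f)
      complement-real f f≢d with restrict-real f f≢d
      ... | p , restrict≡ = trans (restrict≡ S) (trans (S≗¬T (emap f p)) (cong not (sym (restrict≡ T))))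

    imageList : Subset (E G) → List (E G)
    imageList A = collect mᵢ (emap? ∘ fromE) A

    length-imageList : ∀ A → length (imageList A) ≡ restrictCount A
    length-imageList A = trans (length-collect mᵢ _ A) (countFin-cong mᵢ (restrict-emap? A ∘ fromE))

    imageList-unique : ∀ A → Unique (imageList A)
    imageList-unique A = collect-unique mᵢ _ A same-edge
      where
      same-edge : PartialInjective (emap? ∘ fromE)
      same-edge i j hi hj with emap?-just _ _ hi | emap?-just _ _ hj
      ... | p , refl | q , e = fromE-injective i j (emap-injective _ p _ q e)

    ∈-imageList⁻ : ∀ A {x} → x ∈ˡ imageList A → Σ (E graph) (λ f → emap? f ≡ just x) × (x ∈ A)
    ∈-imageList⁻ A x∈ with ∈-collect⁻ mᵢ _ A x∈
    ... | (i , hi) , x∈A = (fromE i , hi) , x∈A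

    ∈-imageList⁺ : ∀ A f {x} → emap? f ≡ just x → x ∈ A → x ∈ˡ imageList A
    ∈-imageList⁺ A f hf x∈A = ∈-collect⁺ mᵢ _ A (toE f) (trans (cong emap? (fromE-toE f)) hf) x∈A

    listed⇒emap? : ∀ A f q → emap f q ∈ˡ imageList A → emap? f ≡ just (emap f q)
    listed⇒emap? A f q listed with ∈-imageList⁻ A listed
    ... | (f′ , hf′) , _ with emap?-just f′ _ hf′
    ...   | p′ , e with refl ← emap-injective f q f′ p′ e = hf′

    side-complement : ∀ S T → (∀ y → S y ≡ not (T y)) → side S virtual ≡ not (side T virtual) →
      ∀ e → side S e ≡ not (side T e)
    side-complement S T S≗¬T virtual-complement e with ↔-decEq (E↔ finite) e virtual
    ... | yes refl = virtual-complement
    ... | no  e≢d with restrict-real e e≢d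
    ...   | p , restrict≡ = begin
      side S e          ≡⟨ side-real S e e≢d ⟩
      restrict S e      ≡⟨ restrict≡ S ⟩
      S (emap e p)      ≡⟨ S≗¬T (emap e p) ⟩
      not (T (emap e p)) ≡⟨ cong not (sym (restrict≡ T)) ⟩
      not (restrict T e) ≡⟨ cong not (sym (side-real T e e≢d)) ⟩
      not (side T e)    ∎
      where open ≡-Reasoning

  emap₁? : E G₁ → Maybe (E G)
  emap₁? f with ↔-decEq (E↔ F₁) f d₁
  ... | yes _ = nothing
  ... | no  p = just (inj₁ (f , p))

  emap₂? : E G₂ → Maybe (E G)
  emap₂? f with ↔-decEq (E↔ F₂) f d₂
  ... | yes _ = nothing
  ... | no  p = just (inj₂ (f , p))

  summand₁ : Summand
  summand₁ = record
    { graph = G₁ ; finite = F₁ ; virtual = d₁ ; simple = simple₁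
    ; vmap = inj₁ ; emap = λ f p → inj₁ (f , p) ; emap-ends = λ _ _ → refl
    ; vmap-src = refl ; vmap-tgt = refl ; emap-injective = λ { _ _ _ _ refl → refl }
    ; restrict = restrict₁′ ; emap? = emap₁?
    ; restrict-emap? = restrict-emap? ; emap?-virtual = emap?-virtual
    ; emap?-real = emap?-real ; emap?-just = emap?-just
    ; side = side₁′ ; side-real = side-real ; side-virtual = side-virtual }
    where
    restrict-emap? : ∀ A f → maybe′ A false (emap₁? f) ≡ restrict₁′ A f
    restrict-emap? A f with ↔-decEq (E↔ F₁) f d₁
    ... | yes _ = refl
    ... | no  _ = refl
    emap?-virtual : emap₁? d₁ ≡ nothing
    emap?-virtual with ↔-decEq (E↔ F₁) d₁ d₁
    ... | yes _ = refl
    ... | no  n = ⊥-elim (n refl)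
    emap?-real : ∀ f → f ≢ d₁ → Σ (f ≢ d₁) (λ p → emap₁? f ≡ just (inj₁ (f , p)))
    emap?-real f f≢d with ↔-decEq (E↔ F₁) f d₁
    ... | yes e = ⊥-elim (f≢d e)
    ... | no  p = p , refl
    emap?-just : ∀ f x → emap₁? f ≡ just x → Σ (f ≢ d₁) (λ p → x ≡ inj₁ (f , p))
    emap?-just f x eq with ↔-decEq (E↔ F₁) f d₁
    emap?-just f x () | yes _
    emap?-just f x refl | no p = p , refl
    side-real : ∀ A f → f ≢ d₁ → side₁′ A f ≡ restrict₁′ A f
    side-real A f f≢d with ↔-decEq (E↔ F₁) f d₁
    ... | yes e = ⊥-elim (f≢d e)
    ... | no  _ = refl
    side-virtual : ∀ A → side₁′ A d₁ ≡
      (countFin (nE F₁) (restrict₁′ A ∘ Inverse.from (E↔ F₁)) ≡ᵇ (nV F₁ ∸ 2))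
    side-virtual A with ↔-decEq (E↔ F₁) d₁ d₁
    ... | yes _ = refl
    ... | no  n = ⊥-elim (n refl)

  summand₂ : Summand
  summand₂ = record
    { graph = G₂ ; finite = F₂ ; virtual = d₂ ; simple = simple₂
    ; vmap = ι ; emap = λ f p → inj₂ (f , p) ; emap-ends = λ _ _ → refl
    ; vmap-src = ι-src ; vmap-tgt = ι-tgt ; emap-injective = λ { _ _ _ _ refl → refl }
    ; restrict = restrict₂′ ; emap? = emap₂?
    ; restrict-emap? = restrict-emap? ; emap?-virtual = emap?-virtual
    ; emap?-real = emap?-real ; emap?-just = emap?-just
    ; side = side₂′ ; side-real = side-real ; side-virtual = side-virtual }
    where
    restrict-emap? : ∀ A f → maybe′ A false (emap₂? f) ≡ restrict₂′ A f
    restrict-emap? A f with ↔-decEq (E↔ F₂) f d₂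
    ... | yes _ = refl
    ... | no  _ = refl
    emap?-virtual : emap₂? d₂ ≡ nothing
    emap?-virtual with ↔-decEq (E↔ F₂) d₂ d₂
    ... | yes _ = refl
    ... | no  n = ⊥-elim (n refl)
    emap?-real : ∀ f → f ≢ d₂ → Σ (f ≢ d₂) (λ p → emap₂? f ≡ just (inj₂ (f , p)))
    emap?-real f f≢d with ↔-decEq (E↔ F₂) f d₂
    ... | yes e = ⊥-elim (f≢d e)
    ... | no  p = p , refl
    emap?-just : ∀ f x → emap₂? f ≡ just x → Σ (f ≢ d₂) (λ p → x ≡ inj₂ (f , p))
    emap?-just f x eq with ↔-decEq (E↔ F₂) f d₂
    emap?-just f x () | yes _
    emap?-just f x refl | no p = p , refl
    side-real : ∀ A f → f ≢ d₂ → side₂′ A f ≡ restrict₂′ A f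
    side-real A f f≢d with ↔-decEq (E↔ F₂) f d₂
    ... | yes e = ⊥-elim (f≢d e)
    ... | no  _ = refl
    side-virtual : ∀ A → side₂′ A d₂ ≡
      (countFin (nE F₂) (restrict₂′ A ∘ Inverse.from (E↔ F₂)) ≡ᵇ (nV F₂ ∸ 2))
    side-virtual A with ↔-decEq (E↔ F₂) d₂ d₂
    ... | yes _ = refl
    ... | no  n = ⊥-elim (n refl)

  module Part₁ = OnSummand summand₁
  module Part₂ = OnSummand summand₂

  side₁-glue : ∀ A₁ A₂ → SpanningTree G₁ A₁ → ∀ e → side₁′ (glue′ A₁ A₂) e ≡ A₁ e
  side₁-glue A₁ A₂ = Part₁.Glued.side-glued A₁ (glue′ A₁ A₂) (λ _ _ → refl)

  side₂-glue : ∀ A₁ A₂ → SpanningTree G₂ A₂ → ∀ e → side₂′ (glue′ A₁ A₂) e ≡ A₂ e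
  side₂-glue A₁ A₂ = Part₂.Glued.side-glued A₂ (glue′ A₁ A₂) (λ _ _ → refl)

  module AllBispanning (bis₁ : Bispanning G₁) (bis₂ : Bispanning G₂) (bisG : Bispanning G) where
    private
      S* T* : Subset (E G)
      S* = proj₁ (proj₁ bisG)
      T* = proj₂ (proj₁ bisG)
      pair* : IsTreePair G (S* , T*)
      pair* = proj₂ bisG

    open VertexIndexing (spanningTree-connected (treePair-left pair*)) using (indexing; vertexCount-cliqueSum)
    module CG = Components G indexing

    K : ℕ
    K = Indexing.vertexCount indexing

    cliqueEdges : Subset (E G) → List (E G)
    cliqueEdges A = Part₁.imageList A ++ Part₂.imageList A

    length-cliqueEdges : ∀ A → length (cliqueEdges A) ≡ Part₁.restrictCount A + Part₂.restrictCount A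
    length-cliqueEdges A =
      trans (length-++ (Part₁.imageList A)) (cong₂ _+_ (Part₁.length-imageList A) (Part₂.length-imageList A))

    ∈-imageList₁ : ∀ A {x} → x ∈ˡ Part₁.imageList A → Σ (E G₁) (λ f → Σ (f ≢ d₁) (λ p → x ≡ inj₁ (f , p)))
    ∈-imageList₁ A x∈ with Part₁.∈-imageList⁻ A x∈
    ... | (f , hf) , _ = f , emap?-just summand₁ f _ hf
      where open Summand using (emap?-just)

    ∈-imageList₂ : ∀ A {x} → x ∈ˡ Part₂.imageList A → Σ (E G₂) (λ f → Σ (f ≢ d₂) (λ p → x ≡ inj₂ (f , p)))
    ∈-imageList₂ A x∈ with Part₂.∈-imageList⁻ A x∈
    ... | (f , hf) , _ = f , emap?-just summand₂ f _ hf
      where open Summand using (emap?-just)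

    cliqueEdges-unique : ∀ A → Unique (cliqueEdges A)
    cliqueEdges-unique A = ++⁺ (Part₁.imageList-unique A) (Part₂.imageList-unique A) apart
      where
      apart : ∀ {x} → ¬ (x ∈ˡ Part₁.imageList A × x ∈ˡ Part₂.imageList A)
      apart (x∈₁ , x∈₂) with ∈-imageList₁ A x∈₁ | ∈-imageList₂ A x∈₂
      ... | _ , _ , refl | _ , _ , ()

    ∈-cliqueEdges⁻ : ∀ A {x} → x ∈ˡ cliqueEdges A → x ∈ A
    ∈-cliqueEdges⁻ A x∈ with ∈-++⁻ (Part₁.imageList A) x∈
    ... | inj₁ x∈₁ = proj₂ (Part₁.∈-imageList⁻ A x∈₁)
    ... | inj₂ x∈₂ = proj₂ (Part₂.∈-imageList⁻ A x∈₂)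

    ∈-cliqueEdges₁ : ∀ A {f p} → inj₁ (f , p) ∈ˡ cliqueEdges A → inj₁ (f , p) ∈ˡ Part₁.imageList A
    ∈-cliqueEdges₁ A x∈ with ∈-++⁻ (Part₁.imageList A) x∈
    ... | inj₁ x∈₁ = x∈₁
    ... | inj₂ x∈₂ with ∈-imageList₂ A x∈₂
    ...   | _ , _ , ()

    ∈-cliqueEdges₂ : ∀ A {f p} → inj₂ (f , p) ∈ˡ cliqueEdges A → inj₂ (f , p) ∈ˡ Part₂.imageList A
    ∈-cliqueEdges₂ A x∈ with ∈-++⁻ (Part₁.imageList A) x∈
    ... | inj₂ x∈₂ = x∈₂
    ... | inj₁ x∈₁ with ∈-imageList₁ A x∈₁
    ...   | _ , _ , ()

    -- Counting shows that every edge of G is listed: an unlisted edge z would make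
    -- z ∷ cliqueEdges longer than the two spanning trees S*, T* of G can cover.
    every-edge-listed : ∀ z → ¬ ¬ z ∈ˡ cliqueEdges full
    every-edge-listed z z∉ = <-irrefl refl (begin-strict
      suc a + suc b      ≤⟨ +-mono-≤ (tree-bound S* (treePair-left pair*)) (tree-bound T* (treePair-right pair*)) ⟩
      K + K              ≡⟨ double-vertexCount {n₁ = nV F₁} {n₂ = nV F₂} (Part₁.edgeCount bis₁) (Part₂.edgeCount bis₂)
                                              vertexCount-cliqueSum ⟩
      nE F₁ + nE F₂                        ≡⟨ cong₂ _+_ (sym Part₁.restrictCount-all) (sym Part₂.restrictCount-all) ⟩
      suc c₁ + suc c₂                      ≡⟨ cong suc (+-suc c₁ c₂) ⟩
      suc (suc (c₁ + c₂))                  ≡⟨ cong (suc ∘ suc) (sym (length-cliqueEdges full)) ⟩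
      suc (length L)     ≡⟨ cong suc (sym (length-filter-complement S* T* (treePair-complement pair*) L)) ⟩
      suc (a + b)                          <⟨ ≤-reflexive (cong suc (sym (+-suc a b))) ⟩
      suc a + suc b                        ∎)
      where
      open ≤-Reasoning
      c₁ = Part₁.restrictCount full
      c₂ = Part₂.restrictCount full
      L = z ∷ cliqueEdges full
      L-unique : Unique L
      L-unique = ¬Any⇒All¬ _ z∉ ∷ cliqueEdges-unique full
      a = length (filter (λ x → S* x Bool.≟ true) L)
      b = length (filter (λ x → T* x Bool.≟ true) L)
      tree-bound : ∀ A → SpanningTree G A → suc (length (filter (λ x → A x Bool.≟ true) L)) ≤ K
      tree-bound A tree = CG.acyclicList-length (filter A? L) u₀
        (Acyclic⇒AcyclicList G (filter A? L) (filter⁺ A? L-unique) (λ x∈ → proj₂ (∈-filter⁻ A? x∈)) (proj₂ tree))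
        where
        A? = λ x → A x Bool.≟ true

    -- Without function extensionality, proofs p, p′ of f ≢ d₁ need not be equal; counting
    -- recovers the equality of the edges up to double negation.
    witness-irrelevant₁ : ∀ f p p′ → ¬ ¬ (_≡_ {A = E G} (inj₁ (f , p)) (inj₁ (f , p′)))
    witness-irrelevant₁ f p p′ p≠p′ =
      every-edge-listed (inj₁ (f , p)) λ listed → every-edge-listed (inj₁ (f , p′)) λ listed′ →
      p≠p′ (just-injective (trans (sym (Part₁.listed⇒emap? full f p (∈-cliqueEdges₁ full listed)))
                                  (Part₁.listed⇒emap? full f p′ (∈-cliqueEdges₁ full listed′))))

    witness-irrelevant₂ : ∀ f p p′ → ¬ ¬ (_≡_ {A = E G} (inj₂ (f , p)) (inj₂ (f , p′)))
    witness-irrelevant₂ f p p′ p≠p′ =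
      every-edge-listed (inj₂ (f , p)) λ listed → every-edge-listed (inj₂ (f , p′)) λ listed′ →
      p≠p′ (just-injective (trans (sym (Part₂.listed⇒emap? full f p (∈-cliqueEdges₂ full listed)))
                                  (Part₂.listed⇒emap? full f p′ (∈-cliqueEdges₂ full listed′))))

    cliqueEdges-covers : ∀ A x → x ∈ A → ¬ ¬ x ∈ˡ cliqueEdges A
    cliqueEdges-covers A (inj₁ (f , p)) x∈ x∉ with Summand.emap?-real summand₁ f p
    ... | p₀ , h = witness-irrelevant₁ f p p₀ λ e →
      x∉ (subst (_∈ˡ cliqueEdges A) (sym e) (∈-++⁺ˡ (Part₁.∈-imageList⁺ A f h (subst (_∈ A) e x∈))))
    cliqueEdges-covers A (inj₂ (f , p)) x∈ x∉ with Summand.emap?-real summand₂ f p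
    ... | p₀ , h = witness-irrelevant₂ f p p₀ λ e →
      x∉ (subst (_∈ˡ cliqueEdges A) (sym e)
            (∈-++⁺ʳ (Part₁.imageList A) (Part₂.∈-imageList⁺ A f h (subst (_∈ A) e x∈))))

    spanningTree-split : ∀ A → SpanningTree G A → suc (Part₁.restrictCount A + Part₂.restrictCount A) ≡ K
    spanningTree-split A tree = trans (cong suc (sym (length-cliqueEdges A)))
      (CG.spanningTree-length (cliqueEdges A) u₀ (spanningTree-connected tree) (proj₂ tree)
        (cliqueEdges-unique A) (∈-cliqueEdges⁻ A) (cliqueEdges-covers A))

    glue-side : ∀ A x → glue′ (side₁′ A) (side₂′ A) x ≡ A x
    glue-side A (inj₁ (f , p)) with Part₁.restrict-real f p
    ... | p₀ , restrict≡ = trans (Summand.side-real summand₁ A f p)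
      (trans (restrict≡ A) (decidable-stable (_ Bool.≟ _) (λ ne → witness-irrelevant₁ f p₀ p (λ e → ne (cong A e)))))
    glue-side A (inj₂ (f , p)) with Part₂.restrict-real f p
    ... | p₀ , restrict≡ = trans (Summand.side-real summand₂ A f p)
      (trans (restrict≡ A) (decidable-stable (_ Bool.≟ _) (λ ne → witness-irrelevant₂ f p₀ p (λ e → ne (cong A e)))))

    private
      connected* : Connected G (_∈ S*)
      connected* = spanningTree-connected (treePair-left pair*)

    OneVirtual : Subset (E G₁) → Subset (E G₂) → Set
    OneVirtual A₁ A₂ = ((A₁ d₁ ≡ true) × (A₂ d₂ ≡ false)) ⊎ ((A₁ d₁ ≡ false) × (A₂ d₂ ≡ true))

    module _ (A₁ : Subset (E G₁)) (A₂ : Subset (E G₂)) (tree₁ : SpanningTree G₁ A₁) (tree₂ : SpanningTree G₂ A₂) where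
      private
        B : Subset (E G)
        B = glue′ A₁ A₂
        module Gl₁ = Part₁.Glued A₁ B (λ _ _ → refl)
        module Gl₂ = Part₂.Glued A₂ B (λ _ _ → refl)

      -- d₁ ∈ A₁ is replaced by the path of A₂ between the ends of d₂, and vice versa.
      glue-bridge₁ : OneVirtual A₁ A₂ → A₁ d₁ ≡ true → EdgeWalk G (_∈ B) u₀ u₁
      glue-bridge₁ (inj₁ (_ , d₂∉)) _ = cast-walk ι-src ι-tgt
        (Gl₂.lift-glued (λ d₂∈ → ⊥-elim (true≢false (trans (sym d₂∈) d₂∉)))
          (spanningTree-connected tree₂ (src G₂ d₂) (tgt G₂ d₂)))
      glue-bridge₁ (inj₂ (d₁∉ , _)) d₁∈ = ⊥-elim (true≢false (trans (sym d₁∈) d₁∉))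

      glue-bridge₂ : OneVirtual A₁ A₂ → A₂ d₂ ≡ true → EdgeWalk G (_∈ B) u₀ u₁
      glue-bridge₂ (inj₂ (d₁∉ , _)) _ =
        Gl₁.lift-glued (λ d₁∈ → ⊥-elim (true≢false (trans (sym d₁∈) d₁∉)))
          (spanningTree-connected tree₁ (src G₁ d₁) (tgt G₁ d₁))
      glue-bridge₂ (inj₁ (_ , d₂∉)) d₂∈ = ⊥-elim (true≢false (trans (sym d₂∈) d₂∉))

      glue-connected : OneVirtual A₁ A₂ → Connected G (_∈ B)
      glue-connected one u v = reverse-walk (reach u) ++ʷ reach v
        where
        reach : ∀ x → EdgeWalk G (_∈ B) u₀ x
        reach (inj₁ u)           = Gl₁.lift-glued (glue-bridge₁ one) (spanningTree-connected tree₁ (src G₁ d₁) u)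
        reach (inj₂ (v , p , q)) = cast-walk ι-src (ι-canonical connected* v p q)
                                     (Gl₂.lift-glued (glue-bridge₂ one) (spanningTree-connected tree₂ (src G₂ d₂) v))

      glue-size : OneVirtual A₁ A₂ → suc (length (cliqueEdges B)) ≡ K
      glue-size one = trans (cong suc (length-cliqueEdges B)) (size one)
        where
        size : OneVirtual A₁ A₂ → suc (Part₁.restrictCount B + Part₂.restrictCount B) ≡ K
        size (inj₁ (d₁∈ , d₂∉)) = glue-count₁ vertexCount-cliqueSum
          (trans (cong suc (Gl₁.restrictCount-in d₁∈)) (Part₁.spanningTree-count A₁ tree₁))
          (trans (cong suc (Gl₂.restrictCount-out d₂∉)) (Part₂.spanningTree-count A₂ tree₂))
        size (inj₂ (d₁∉ , d₂∈)) = glue-count₂ vertexCount-cliqueSum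
          (trans (cong suc (Gl₁.restrictCount-out d₁∉)) (Part₁.spanningTree-count A₁ tree₁))
          (trans (cong suc (Gl₂.restrictCount-in d₂∈)) (Part₂.spanningTree-count A₂ tree₂))

      glue-spanningTree : OneVirtual A₁ A₂ → SpanningTree G B
      glue-spanningTree one = spanningTree (glue-connected one)
        (CG.connected-short⇒acyclic (cliqueEdges B) (glue-connected one) (cliqueEdges-covers B)
                                    (≤-reflexive (glue-size one)))

    glue-treePair : ∀ S₁ T₁ S₂ T₂ → IsTreePair G₁ (S₁ , T₁) → IsTreePair G₂ (S₂ , T₂) →
      ηCond G₁ G₂ F₁ F₂ d₁ d₂ (S₁ , T₁) (S₂ , T₂) →
      IsTreePair G (glue′ S₁ S₂ , glue′ T₁ T₂)
    glue-treePair S₁ T₁ S₂ T₂ pair₁ pair₂ η = complement-treePair complement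
      (glue-spanningTree S₁ S₂ (treePair-left pair₁) (treePair-left pair₂) oneS)
      (glue-spanningTree T₁ T₂ (treePair-right pair₁) (treePair-right pair₂) oneT)
      where
      complement : ∀ e → glue′ S₁ S₂ e ≡ not (glue′ T₁ T₂ e)
      complement (inj₁ (f , _)) = treePair-complement pair₁ f
      complement (inj₂ (f , _)) = treePair-complement pair₂ f
      T-is-¬S : ∀ {H S T} → IsTreePair H (S , T) → ∀ e → T e ≡ not (S e)
      T-is-¬S pair e = trans (sym (not-involutive _)) (cong not (sym (treePair-complement pair e)))
      one : OneVirtual S₁ S₂ × OneVirtual T₁ T₂
      one with S₁ d₁ | S₂ d₂ | T-is-¬S pair₁ d₁ | T-is-¬S pair₂ d₂
      ... | true  | true  | _  | _  = ⊥-elim (η (inj₁ (refl , refl)))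
      ... | true  | false | t₁ | t₂ = inj₁ (refl , refl) , inj₂ (t₁ , t₂)
      ... | false | true  | t₁ | t₂ = inj₂ (refl , refl) , inj₁ (t₁ , t₂)
      ... | false | false | t₁ | t₂ = ⊥-elim (η (inj₂ (t₁ , t₂)))
      oneS = proj₁ one
      oneT = proj₂ one

    bridge₁ : ∀ A → Acyclic G (_∈ A) → suc (Part₁.restrictCount A) ≡ nV F₁ →
      EdgeWalk G (λ z → z ∈ A × (∀ f p → z ≢ inj₂ (f , p))) u₀ u₁
    bridge₁ A acyclic size = Part₁.bridge A acyclic size real
      where
      real : ∀ f → f ∈ restrict₁′ A → f ≢ d₁ →
        Σ (f ≢ d₁) (λ p → (inj₁ (f , p) ∈ A) × (∀ g q → _≡_ {A = E G} (inj₁ (f , p)) (inj₂ (g , q)) → ⊥))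
      real f f∈ f≢d with Part₁.restrict-real f f≢d
      ... | p , restrict≡ = p , trans (sym (restrict≡ A)) f∈ , λ _ _ ()

    bridge₂ : ∀ A → Acyclic G (_∈ A) → suc (Part₂.restrictCount A) ≡ nV F₂ →
      EdgeWalk G (λ z → z ∈ A × (∀ f p → z ≢ inj₁ (f , p))) u₀ u₁
    bridge₂ A acyclic size = Part₂.bridge A acyclic size real
      where
      real : ∀ f → f ∈ restrict₂′ A → f ≢ d₂ →
        Σ (f ≢ d₂) (λ p → (inj₂ (f , p) ∈ A) × (∀ g q → _≡_ {A = E G} (inj₂ (f , p)) (inj₁ (g , q)) → ⊥))
      real f f∈ f≢d with Part₂.restrict-real f f≢d
      ... | p , restrict≡ = p , trans (sym (restrict≡ A)) f∈ , λ _ _ ()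

    -- X restricts to a spanning tree of G₁ - d₁ and Y to one with two components; the counts
    -- then force the opposite on G₂, and each short restriction is completed by its dᵢ.
    record Crossing (X Y : Subset (E G)) : Set where
      field
        X₁ : (side₁′ X d₁ ≡ false) × SpanningTree G₁ (side₁′ X)
        Y₁ : (side₁′ Y d₁ ≡ true)  × SpanningTree G₁ (side₁′ Y)
        X₂ : (side₂′ X d₂ ≡ true)  × SpanningTree G₂ (side₂′ X)
        Y₂ : (side₂′ Y d₂ ≡ false) × SpanningTree G₂ (side₂′ Y)

    crossing : ∀ X Y → SpanningTree G X → SpanningTree G Y →
      suc (Part₁.restrictCount X) ≡ nV F₁ → suc (suc (Part₁.restrictCount Y)) ≡ nV F₁ → Crossing X Y
    crossing X Y treeX treeY X-full Y-short = record
      { X₁ = Part₁.side-full X (proj₂ treeX) X-full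
      ; Y₁ = Part₁.side-added Y (proj₂ treeY) Y-short (bridge₂ Y (proj₂ treeY) Y-full₂)
      ; X₂ = Part₂.side-added X (proj₂ treeX) X-short₂ (bridge₁ X (proj₂ treeX) X-full)
      ; Y₂ = Part₂.side-full Y (proj₂ treeY) Y-full₂ }
      where
      X-short₂ : suc (suc (Part₂.restrictCount X)) ≡ nV F₂
      X-short₂ = split-count₁ vertexCount-cliqueSum (spanningTree-split X treeX) X-full
      Y-full₂ : suc (Part₂.restrictCount Y) ≡ nV F₂
      Y-full₂ = split-count₂ vertexCount-cliqueSum (spanningTree-split Y treeY) Y-short

    SidePairs : Subset (E G) → Subset (E G) → Set
    SidePairs S T =
      IsTreePair G₁ (side₁′ S , side₁′ T) ×
      IsTreePair G₂ (side₂′ S , side₂′ T) ×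
      ηCond G₁ G₂ F₁ F₂ d₁ d₂ (side₁′ S , side₁′ T)
                              (side₂′ S , side₂′ T)

    sidePairs-swap : ∀ {S T} → SidePairs S T → SidePairs T S
    sidePairs-swap (pair₁ , pair₂ , η) = treePair-swap pair₁ , treePair-swap pair₂ , η ∘ Data.Sum.swap

    crossing-sidePairs : ∀ X Y → (∀ y → X y ≡ not (Y y)) → Crossing X Y → SidePairs X Y
    crossing-sidePairs X Y X≗¬Y c =
      complement-treePair (Part₁.side-complement X Y X≗¬Y (trans (proj₁ X₁) (cong not (sym (proj₁ Y₁)))))
                          (proj₂ X₁) (proj₂ Y₁) ,
      complement-treePair (Part₂.side-complement X Y X≗¬Y (trans (proj₁ X₂) (cong not (sym (proj₁ Y₂)))))
                          (proj₂ X₂) (proj₂ Y₂) ,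
      λ { (inj₁ (d₁∈ , _)) → true≢false (trans (sym d₁∈) (proj₁ X₁))
        ; (inj₂ (_ , d₂∈)) → true≢false (trans (sym d₂∈) (proj₁ Y₂)) }
      where open Crossing c

    side-treePairs : ∀ S T → IsTreePair G (S , T) → SidePairs S T
    side-treePairs S T pair = by-cases
      (forced-split (Part₁.restrict-size S (proj₂ treeS)) (Part₁.restrict-size T (proj₂ treeT))
                    (Part₁.restrictCount-complement S T S≗¬T) (Part₁.edgeCount bis₁))
      where
      treeS = treePair-left pair
      treeT = treePair-right pair
      S≗¬T = treePair-complement pair
      T≗¬S = treePair-complement (treePair-swap pair)
      by-cases : ((suc (Part₁.restrictCount S) ≡ nV F₁) × (suc (suc (Part₁.restrictCount T)) ≡ nV F₁)) ⊎
                 ((suc (suc (Part₁.restrictCount S)) ≡ nV F₁) × (suc (Part₁.restrictCount T) ≡ nV F₁)) → SidePairs S T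
      by-cases (inj₁ (S-full , T-short)) = crossing-sidePairs S T S≗¬T (crossing S T treeS treeT S-full T-short)
      by-cases (inj₂ (S-short , T-full)) =
        sidePairs-swap (crossing-sidePairs T S T≗¬S (crossing T S treeT treeS T-full S-short))

mainTheorem14 :
  (G₁ G₂ : Graph) (F₁ : Finite G₁) (F₂ : Finite G₂) (d₁ : E G₁) (d₂ : E G₂) →
  Simple G₁ → Simple G₂ → Bispanning G₁ → Bispanning G₂ →
  Bispanning (cliqueSum G₁ G₂ F₂ d₁ d₂) →
  Atomic (cliqueSum G₁ G₂ F₂ d₁ d₂) →
  VertexConnectivity2 (cliqueSum G₁ G₂ F₂ d₁ d₂) →
  ((x : Vη G₁ G₂ F₁ F₂ d₁ d₂) →
    IsTreePair (cliqueSum G₁ G₂ F₂ d₁ d₂) (η G₁ G₂ F₁ F₂ d₁ d₂ x)) ×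
  ((y : Vτ (cliqueSum G₁ G₂ F₂ d₁ d₂)) →
    IsTreePair G₁ (proj₁ (θ G₁ G₂ F₁ F₂ d₁ d₂ (proj₁ y))) ×
    IsTreePair G₂ (proj₂ (θ G₁ G₂ F₁ F₂ d₁ d₂ (proj₁ y))) ×
    ηCond G₁ G₂ F₁ F₂ d₁ d₂ (proj₁ (θ G₁ G₂ F₁ F₂ d₁ d₂ (proj₁ y)))
                             (proj₂ (θ G₁ G₂ F₁ F₂ d₁ d₂ (proj₁ y)))) ×
  ((x : Vη G₁ G₂ F₁ F₂ d₁ d₂) →
    (proj₁ (proj₁ (θ G₁ G₂ F₁ F₂ d₁ d₂ (η G₁ G₂ F₁ F₂ d₁ d₂ x))) ≐ proj₁ (proj₁ (proj₁ (proj₁ x)))) ×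
    (proj₂ (proj₁ (θ G₁ G₂ F₁ F₂ d₁ d₂ (η G₁ G₂ F₁ F₂ d₁ d₂ x))) ≐ proj₂ (proj₁ (proj₁ (proj₁ x)))) ×
    (proj₁ (proj₂ (θ G₁ G₂ F₁ F₂ d₁ d₂ (η G₁ G₂ F₁ F₂ d₁ d₂ x))) ≐ proj₁ (proj₁ (proj₂ (proj₁ x)))) ×
    (proj₂ (proj₂ (θ G₁ G₂ F₁ F₂ d₁ d₂ (η G₁ G₂ F₁ F₂ d₁ d₂ x))) ≐ proj₂ (proj₁ (proj₂ (proj₁ x))))) ×
  ((y : Vτ (cliqueSum G₁ G₂ F₂ d₁ d₂)) →
    (glue G₁ G₂ F₁ F₂ d₁ d₂ (proj₁ (proj₁ (θ G₁ G₂ F₁ F₂ d₁ d₂ (proj₁ y))))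
                            (proj₁ (proj₂ (θ G₁ G₂ F₁ F₂ d₁ d₂ (proj₁ y)))) ≐ proj₁ (proj₁ y)) ×
    (glue G₁ G₂ F₁ F₂ d₁ d₂ (proj₂ (proj₁ (θ G₁ G₂ F₁ F₂ d₁ d₂ (proj₁ y))))
                            (proj₂ (proj₂ (θ G₁ G₂ F₁ F₂ d₁ d₂ (proj₁ y)))) ≐ proj₂ (proj₁ y)))
mainTheorem14 G₁ G₂ F₁ F₂ d₁ d₂ simple₁ simple₂ bis₁ bis₂ bisG _ _ =
  (λ { (((_ , pair₁) , (_ , pair₂)) , η) → glue-treePair _ _ _ _ pair₁ pair₂ η }) ,
  (λ { ((S , T) , pair) → side-treePairs S T pair }) ,
  (λ { ((((S₁ , T₁) , pair₁) , ((S₂ , T₂) , pair₂)) , _) →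
         side₁-glue S₁ S₂ (treePair-left pair₁) , side₁-glue T₁ T₂ (treePair-right pair₁) ,
         side₂-glue S₁ S₂ (treePair-left pair₂) , side₂-glue T₁ T₂ (treePair-right pair₂) }) ,
  (λ { ((S , T) , _) → glue-side S , glue-side T })
  where
  open CliqueSum G₁ G₂ F₁ F₂ d₁ d₂ simple₁ simple₂
  open AllBispanning bis₁ bis₂ bisG
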